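{- Let $n\ge1$ and $I,J\subseteq\{1,\dots,n-1\}$ with $n$-compositions $[I]_n=(p_1,\dots,p_k)$ and $[J]_n=(q_1,\dots,q_\ell)$. Then $\widehat a_{n,I,J}$ equals the number of $k\times\ell$ matrices with non-negative integer entries whose $i$th row sums to $p_i$ for every $i$ and whose $j$th column sums to $q_j$ for every $j$. In particular $$\widehat a_{n,I,\emptyset}=\frac{n!}{p_1!\cdots p_k!}\quad\text{and}\quad \widehat a_{n,\emptyset,J}=\frac{n!}{q_1!\cdots q_\ell!}.$$
   Context: $B_n^+$ is the monoid generated by $\sigma_1,\dots,\sigma_{n-1}$ subject to $\sigma_i\sigma_j=\sigma_j\sigma_i$ for $|i-j|\ge 2$ and $\sigma_i\sigma_j\sigma_i=\sigma_j\sigma_i\sigma_j$ for $|i-j|=1$. Define $\Delta_1=1$, $\Delta_n=\sigma_1\cdots\sigma_{n-1}\Delta_{n-1}$; a positive $n$-braid is simple if it left-divides $\Delta_n$. For simple $x$, $D_L(x)$ (resp. $D_R(x)$) is the set of $i\in\{1,\dots,n-1\}$ with $\sigma_i$ a left (resp. right) divisor of $x$. $\widehat a_{n,I,J}$ is the number of simple $n$-braids $x$ with $D_L(x)\supseteq I$ and $D_R(x)\supseteq J$. For $I\subseteq\{1,\dots,n-1\}$ with $p_1<\dots<p_k$ the increasing enumeration of $\{1,\dots,n\}\setminus I$, the $n$-composition of $I$ is $[I]_n=(p_1,p_2-p_1,\dots,p_k-p_{k-1})$. -}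

module Defs where

open import Data.Nat using (ℕ; zero; suc; _+_; _∸_; _≤_; ∣_-_∣)
open import Data.Bool using (Bool; true; false; if_then_else_)
open import Data.Fin using (Fin; toℕ; inject₁)
open import Data.Fin.Subset using (Subset; _∈_)
open import Data.List using (List; []; _∷_; _++_; [_]; map; allFin; tabulate; concatMap; length; lookup)
open import Data.Nat.ListAction using (sum)
open import Data.Vec using () renaming (lookup to vlookup)
open import Data.Product using (Σ; ∃; _×_)
open import Relation.Binary.PropositionalEquality using (_≡_)

-- Throughout, n = suc m, and the generator σ_{i+1} (1 ≤ i+1 ≤ n-1) is
-- represented by i : Fin m.  Positive braid words are lists of generators.

Word : ℕ → Set
Word m = List (Fin m)

data Rel {m : ℕ} : Word m → Word m → Set where
  far  : (i j : Fin m) → 2 ≤ ∣ toℕ i - toℕ j ∣ → Rel (i ∷ j ∷ []) (j ∷ i ∷ [])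
  near : (i j : Fin m) → ∣ toℕ i - toℕ j ∣ ≡ 1 → Rel (i ∷ j ∷ i ∷ []) (j ∷ i ∷ j ∷ [])

data _≈_ {m : ℕ} : Word m → Word m → Set where
  step  : (a u v b : Word m) → Rel u v → (a ++ u ++ b) ≈ (a ++ v ++ b)
  refl  : (u : Word m) → u ≈ u
  sym   : {u v : Word m} → u ≈ v → v ≈ u
  trans : {u v w : Word m} → u ≈ v → v ≈ w → u ≈ w

-- Δ m is Δ_{m+1}:  Δ_1 = 1,  Δ_{k+1} = σ_1 ⋯ σ_k Δ_k
Δ : (m : ℕ) → Word m
Δ zero    = []
Δ (suc m) = allFin (suc m) ++ map inject₁ (Δ m)

_≼_ : {m : ℕ} → Word m → Word m → Set
_≼_ {m} x y = Σ (Word m) (λ z → (x ++ z) ≈ y)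

IsSimple : (m : ℕ) → Word m → Set
IsSimple m x = x ≼ Δ m

InDL : {m : ℕ} → Fin m → Word m → Set
InDL {m} i x = Σ (Word m) (λ z → (i ∷ z) ≈ x)

InDR : {m : ℕ} → Fin m → Word m → Set
InDR {m} i x = Σ (Word m) (λ z → (z ++ [ i ]) ≈ x)

SimpleIJ : (m : ℕ) → Subset m → Subset m → Word m → Set
SimpleIJ m I J x = IsSimple m x × (∀ i → i ∈ I → InDL i x) × (∀ j → j ∈ J → InDR j x)

record Counts {A : Set} (_~_ : A → A → Set) (P : A → Set) (N : ℕ) : Set where
  field
    elem     : Fin N → A
    valid    : ∀ k → P (elem k)
    distinct : ∀ k k' → elem k ~ elem k' → k ≡ k'
    cover    : ∀ x → P x → ∃ λ k → elem k ~ x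

AHat : (m : ℕ) → Subset m → Subset m → ℕ → Set
AHat m I J N = Counts (_≈_ {m}) (SimpleIJ m I J) N

-- increasing enumeration of {1,…,n} ∖ I  (n = suc m; i : Fin m stands for toℕ i + 1)
complementList : (m : ℕ) → Subset m → List ℕ
complementList m I =
  concatMap (λ i → if vlookup I i then [] else [ suc (toℕ i) ]) (allFin m) ++ [ suc m ]

diffs : ℕ → List ℕ → List ℕ
diffs prev []       = []
diffs prev (x ∷ xs) = (x ∸ prev) ∷ diffs x xs

composition : (m : ℕ) → Subset m → List ℕ
composition m I = diffs 0 (complementList m I)

Matrix : ℕ → ℕ → Set
Matrix k l = Fin k → Fin l → ℕ

_≗M_ : {k l : ℕ} → Matrix k l → Matrix k l → Set
M ≗M M' = ∀ i j → M i j ≡ M' i j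

RowColSums : (p q : List ℕ) → Matrix (length p) (length q) → Set
RowColSums p q M =
  (∀ i → sum (tabulate (λ j → M i j)) ≡ lookup p i) ×
  (∀ j → sum (tabulate (λ i → M i j)) ≡ lookup q j)

-- A positive braid word acts on [0, …, m] by adjacent transpositions, and the number of inversions of the
-- resulting permutation is at most the length of the word.  Equality holds for Δ, hence for every left
-- divisor of Δ, so simple braids are reduced words.  Every reduced word equals, in B_n^+, the word of a
-- unique code (the positions at which 1, …, m are successively inserted into [0]), and σ_{i+1} is a
-- left (right) descent exactly when the values i, i+1 (the entries at positions i, i+1) are inverted.
--
-- If I ⊆ D_L(x), the values in each block of [I]_n occur in decreasing order, so replacing every value by
-- its block loses nothing: the simple braids counted by â_{n,I,J} correspond to the words with content
-- [I]_n that weakly descend at every position of J.  Cutting such a word at the positions outside J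
-- leaves descending segments, and counting the letters of each segment gives a matrix with row sums
-- [I]_n and column sums [J]_n, which in turn determines the word.  For J = ∅ the words are all
-- rearrangements of a multiset, counted by the multinomial coefficient; transposing the matrices
-- exchanges I and J.

module Submission where

open import Defs renaming (refl to ≈-refl; sym to ≈-sym; trans to ≈-trans)

import Algebra.Properties.CommutativeSemigroup as CommutativeSemigroupProperties
open import Data.Bool using (Bool; true; false; if_then_else_; T)
open import Data.Bool.Properties using () renaming (_≟_ to _≟ᵇ_)
open import Data.Empty using (⊥-elim)
open import Data.Fin using (Fin; zero; suc; toℕ; inject₁; fromℕ; fromℕ<; lower₁; remQuot; combine; splitAt; join)
open import Data.Fin.Properties
  using (toℕ-inject₁; toℕ-fromℕ; toℕ-fromℕ<; toℕ-injective; toℕ<n; inject₁-lower₁;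
         splitAt-join; join-splitAt; remQuot-combine; combine-remQuot; injective⇒≤)
import Data.Fin.Properties as Fin
open import Data.Fin.Subset using (Subset; ⊥; _∈_)
open import Data.List using (List; []; _∷_; _++_; [_]; map; length; reverse; tabulate; allFin; concat; replicate; lookup)
open import Data.List.Properties
  using (++-assoc; ++-identityʳ; map-++; length-++; length-map; length-replicate; length-tabulate; map-∘; map-cong;
         map-cong-local; map-id; map-tabulate; tabulate-cong; tabulate-lookup; concat-map; unfold-reverse; reverse-++;
         reverse-involutive; ∷-injective)
open import Data.List.Relation.Unary.All using (All; []; _∷_)
import Data.List.Relation.Unary.All as All
open import Data.List.Relation.Unary.All.Properties using (map⁺; ++⁺; ++⁻ˡ; ++⁻ʳ)
open import Data.List.Relation.Unary.Linked using (Linked; []; [-]; _∷_)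
import Data.List.Relation.Unary.Linked as Linked
open import Data.List.Relation.Unary.Linked.Properties using (Linked⇒All)
open import Data.Nat
  using (ℕ; zero; suc; _+_; _*_; _∸_; _!; _≤_; _<_; _≥_; z≤n; s≤s; ∣_-_∣; _<ᵇ_; _≤ᵇ_; _≡ᵇ_; _≤?_; _<?_; _≟_; pred)
open import Data.Nat.ListAction using (sum; product)
open import Data.Nat.ListAction.Properties using (sum-++)
open import Data.Nat.Properties
open import Data.Product using (Σ; _×_; _,_; proj₁; proj₂; uncurry)
open import Data.Sum using (_⊎_; inj₁; inj₂)
open import Data.Unit using (⊤; tt)
open import Data.Vec using ([]; _∷_; here; there) renaming (lookup to vlookup)
open import Function using (_∘_)
open import Level using (0ℓ)
open import Relation.Binary.Bundles using (Setoid)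
open import Relation.Binary.Definitions using (tri<; tri≈; tri>)
open import Relation.Binary.PropositionalEquality
  using (_≡_; _≢_; refl; sym; trans; cong; cong₂; subst; subst₂; module ≡-Reasoning)
import Relation.Binary.Reasoning.Setoid as SetoidReasoning
open import Relation.Nullary using (¬_; Dec; yes; no)
open import Relation.Nullary.Decidable using (map′; _×-dec_; _→-dec_)

open CommutativeSemigroupProperties +-commutativeSemigroup using (x∙yz≈y∙xz; interchange)
open CommutativeSemigroupProperties *-commutativeSemigroup using () renaming (x∙yz≈y∙xz to x∙yz≈y∙xz*)

private variable m : ℕ

≡⇒≈ : {u v : Word m} → u ≡ v → u ≈ v
≡⇒≈ {u = u} refl = ≈-refl u

≈-setoid : ℕ → Setoid 0ℓ 0ℓ
≈-setoid m = record
  { Carrier = Word m ; _≈_ = _≈_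
  ; isEquivalence = record { refl = ≈-refl _ ; sym = ≈-sym ; trans = ≈-trans } }

module ≈-Reasoning {m : ℕ} = SetoidReasoning (≈-setoid m)

≈-in-context : (a : Word m) {u v : Word m} (b : Word m) → u ≈ v → (a ++ u ++ b) ≈ (a ++ v ++ b)
≈-in-context a b (step a′ u v b′ r) =
  subst₂ _≈_ (regroup u) (regroup v) (step (a ++ a′) u v (b′ ++ b) r)
  where
  regroup : ∀ x → (a ++ a′) ++ x ++ (b′ ++ b) ≡ a ++ (a′ ++ x ++ b′) ++ b
  regroup x = trans (++-assoc a a′ (x ++ b′ ++ b))
    (cong (a ++_) (sym (trans (++-assoc a′ (x ++ b′) b) (cong (a′ ++_) (++-assoc x b′ b)))))
≈-in-context a b (≈-refl u)     = ≈-refl _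
≈-in-context a b (≈-sym p)      = ≈-sym (≈-in-context a b p)
≈-in-context a b (≈-trans p q)  = ≈-trans (≈-in-context a b p) (≈-in-context a b q)

++-congˡ : (a : Word m) {u v : Word m} → u ≈ v → (a ++ u) ≈ (a ++ v)
++-congˡ a {u} {v} p =
  subst₂ _≈_ (cong (a ++_) (++-identityʳ u)) (cong (a ++_) (++-identityʳ v)) (≈-in-context a [] p)

++-congʳ : {u v : Word m} (b : Word m) → u ≈ v → (u ++ b) ≈ (v ++ b)
++-congʳ b = ≈-in-context [] b

length-≈ : {u v : Word m} → u ≈ v → length u ≡ length v
length-≈ (step a u v b r) = begin
  length (a ++ u ++ b)          ≡⟨ length-++ a ⟩
  length a + length (u ++ b)    ≡⟨ cong (length a +_) (length-++ u) ⟩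
  length a + (length u + length b) ≡⟨ cong (λ k → length a + (k + length b)) (length-Rel r) ⟩
  length a + (length v + length b) ≡⟨ cong (length a +_) (length-++ v) ⟨
  length a + length (v ++ b)    ≡⟨ length-++ a ⟨
  length (a ++ v ++ b)          ∎
  where
  open ≡-Reasoning
  length-Rel : {u v : Word _} → Rel u v → length u ≡ length v
  length-Rel (far _ _ _)  = refl
  length-Rel (near _ _ _) = refl
length-≈ (≈-refl u)    = refl
length-≈ (≈-sym p)     = sym (length-≈ p)
length-≈ (≈-trans p q) = trans (length-≈ p) (length-≈ q)

module _ {m m′ : ℕ} (f : Fin m → Fin m′)
         (f-isometry : ∀ i j → ∣ toℕ (f i) - toℕ (f j) ∣ ≡ ∣ toℕ i - toℕ j ∣) where

  ≈-map : {u v : Word m} → u ≈ v → map f u ≈ map f v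
  ≈-map (step a u v b r) = subst₂ _≈_ (sym (map-++₃ u)) (sym (map-++₃ v))
    (step (map f a) (map f u) (map f v) (map f b) (Rel-map r))
    where
    map-++₃ : (x : Word m) → map f (a ++ x ++ b) ≡ map f a ++ map f x ++ map f b
    map-++₃ x = trans (map-++ f a (x ++ b)) (cong (map f a ++_) (map-++ f x b))
    Rel-map : {u v : Word m} → Rel u v → Rel (map f u) (map f v)
    Rel-map (far i j d)  = far (f i) (f j) (subst (2 ≤_) (sym (f-isometry i j)) d)
    Rel-map (near i j d) = near (f i) (f j) (trans (f-isometry i j) d)
  ≈-map (≈-refl u)    = ≈-refl _
  ≈-map (≈-sym p)     = ≈-sym (≈-map p)
  ≈-map (≈-trans p q) = ≈-trans (≈-map p) (≈-map q)

≈-map-inject₁ : {u v : Word m} → u ≈ v → map inject₁ u ≈ map inject₁ v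
≈-map-inject₁ = ≈-map inject₁ (λ i j → cong₂ ∣_-_∣ (toℕ-inject₁ i) (toℕ-inject₁ j))

≈-map-suc : {u v : Word m} → u ≈ v → map suc u ≈ map suc v
≈-map-suc = ≈-map suc (λ _ _ → refl)

m+2≤n⇒2≤∣m-n∣ : ∀ m n → m + 2 ≤ n → 2 ≤ ∣ m - n ∣
m+2≤n⇒2≤∣m-n∣ zero    n       h       = h
m+2≤n⇒2≤∣m-n∣ (suc m) (suc n) (s≤s h) = m+2≤n⇒2≤∣m-n∣ m n h

m+2≤n⇒2≤∣n-m∣ : ∀ m n → m + 2 ≤ n → 2 ≤ ∣ n - m ∣
m+2≤n⇒2≤∣n-m∣ m n h = subst (2 ≤_) (∣-∣-comm m n) (m+2≤n⇒2≤∣m-n∣ m n h)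

∣m-n∣≡1⇒adjacent : ∀ m n → ∣ m - n ∣ ≡ 1 → (n ≡ suc m) ⊎ (m ≡ suc n)
∣m-n∣≡1⇒adjacent zero          (suc zero)    _ = inj₁ refl
∣m-n∣≡1⇒adjacent (suc zero)    zero          _ = inj₂ refl
∣m-n∣≡1⇒adjacent (suc m)       (suc n)       h with ∣m-n∣≡1⇒adjacent m n h
... | inj₁ e = inj₁ (cong suc e)
... | inj₂ e = inj₂ (cong suc e)

2≤∣m-n∣⇒far : ∀ m n → 2 ≤ ∣ m - n ∣ → (m + 2 ≤ n) ⊎ (n + 2 ≤ m)
2≤∣m-n∣⇒far zero    n       h = inj₁ h
2≤∣m-n∣⇒far (suc m) zero    h = inj₂ (subst (_≤ suc m) (+-comm 2 zero) h)
2≤∣m-n∣⇒far (suc m) (suc n) h with 2≤∣m-n∣⇒far m n h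
... | inj₁ e = inj₁ (s≤s e)
... | inj₂ e = inj₂ (s≤s e)

FarFrom : Fin m → Word m → Set
FarFrom i w = All (λ t → 2 ≤ ∣ toℕ i - toℕ t ∣) w

FarFrom-comm : (i : Fin m) (w : Word m) → FarFrom i w → (w ++ [ i ]) ≈ (i ∷ w)
FarFrom-comm i []      []       = ≈-refl _
FarFrom-comm i (t ∷ w) (d ∷ ds) = ≈-trans (++-congˡ [ t ] (FarFrom-comm i w ds))
  (step [] (t ∷ i ∷ []) (i ∷ t ∷ []) w (far t i (subst (2 ≤_) (∣-∣-comm (toℕ i) (toℕ t)) d)))

FarFrom-if-above : (i : Fin m) (w : Word m) {k : ℕ} → toℕ i + 2 ≤ k → All (λ t → k ≤ toℕ t) w → FarFrom i w
FarFrom-if-above i w h = All.map (λ q → m+2≤n⇒2≤∣m-n∣ (toℕ i) _ (≤-trans h q))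

FarFrom-if-below : (i : Fin m) (w : Word m) → All (λ t → toℕ t + 2 ≤ toℕ i) w → FarFrom i w
FarFrom-if-below i w = All.map (λ {t} q → m+2≤n⇒2≤∣n-m∣ (toℕ t) (toℕ i) q)

module _ {A : Set} where

  swapAdjacent : ℕ → List A → List A
  swapAdjacent zero    []          = []
  swapAdjacent zero    (a ∷ [])    = a ∷ []
  swapAdjacent zero    (a ∷ b ∷ L) = b ∷ a ∷ L
  swapAdjacent (suc i) []          = []
  swapAdjacent (suc i) (a ∷ L)     = a ∷ swapAdjacent i L

  applySwaps : List ℕ → List A → List A
  applySwaps []      L = L
  applySwaps (i ∷ w) L = applySwaps w (swapAdjacent i L)

  applyWord : Word m → List A → List A
  applyWord w = applySwaps (map toℕ w)

  length-swapAdjacent : ∀ i (L : List A) → length (swapAdjacent i L) ≡ length L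
  length-swapAdjacent zero    []          = refl
  length-swapAdjacent zero    (a ∷ [])    = refl
  length-swapAdjacent zero    (a ∷ b ∷ L) = refl
  length-swapAdjacent (suc i) []          = refl
  length-swapAdjacent (suc i) (a ∷ L)     = cong suc (length-swapAdjacent i L)

  length-applySwaps : ∀ w (L : List A) → length (applySwaps w L) ≡ length L
  length-applySwaps []      L = refl
  length-applySwaps (i ∷ w) L = trans (length-applySwaps w (swapAdjacent i L)) (length-swapAdjacent i L)

  length-applyWord : ∀ (w : Word m) (L : List A) → length (applyWord w L) ≡ length L
  length-applyWord w = length-applySwaps (map toℕ w)

  swapAdjacent-involutive : ∀ i (L : List A) → swapAdjacent i (swapAdjacent i L) ≡ L
  swapAdjacent-involutive zero    []          = refl
  swapAdjacent-involutive zero    (a ∷ [])    = refl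
  swapAdjacent-involutive zero    (a ∷ b ∷ L) = refl
  swapAdjacent-involutive (suc i) []          = refl
  swapAdjacent-involutive (suc i) (a ∷ L)     = cong (a ∷_) (swapAdjacent-involutive i L)

  swapAdjacent-comm : ∀ i j (L : List A) → i + 2 ≤ j →
    swapAdjacent i (swapAdjacent j L) ≡ swapAdjacent j (swapAdjacent i L)
  swapAdjacent-comm zero    (suc zero)    L           (s≤s ())
  swapAdjacent-comm zero    (suc (suc j)) []          h       = refl
  swapAdjacent-comm zero    (suc (suc j)) (a ∷ [])    h       = refl
  swapAdjacent-comm zero    (suc (suc j)) (a ∷ b ∷ L) h       = refl
  swapAdjacent-comm (suc i) (suc j)       []          h       = refl
  swapAdjacent-comm (suc i) (suc j)       (a ∷ L)     (s≤s h) = cong (a ∷_) (swapAdjacent-comm i j L h)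

  swapAdjacent-braid : ∀ i (L : List A) → i + 3 ≤ length L →
    swapAdjacent i (swapAdjacent (suc i) (swapAdjacent i L)) ≡
    swapAdjacent (suc i) (swapAdjacent i (swapAdjacent (suc i) L))
  swapAdjacent-braid zero    (a ∷ [])        (s≤s ())
  swapAdjacent-braid zero    (a ∷ b ∷ [])    (s≤s (s≤s ()))
  swapAdjacent-braid zero    (a ∷ b ∷ c ∷ L) h       = refl
  swapAdjacent-braid (suc i) (a ∷ L)         (s≤s h) = cong (a ∷_) (swapAdjacent-braid i L h)

  applySwaps-++ : ∀ u v (L : List A) → applySwaps (u ++ v) L ≡ applySwaps v (applySwaps u L)
  applySwaps-++ []      v L = refl
  applySwaps-++ (i ∷ u) v L = applySwaps-++ u v (swapAdjacent i L)

  applyWord-++ : ∀ (u v : Word m) (L : List A) → applyWord (u ++ v) L ≡ applyWord v (applyWord u L)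
  applyWord-++ u v L =
    trans (cong (λ z → applySwaps z L) (map-++ toℕ u v)) (applySwaps-++ (map toℕ u) (map toℕ v) L)

  braid-fits : ∀ {k} (j : Fin m) (L : List A) → length L ≡ suc m → toℕ j ≡ suc k → k + 3 ≤ length L
  braid-fits {m} {k} j L len e = subst (k + 3 ≤_) (sym len)
    (subst (_≤ suc m) (sym (+-comm k 3)) (s≤s (subst (_< m) e (toℕ<n j))))

  applyWord-Rel : {u v : Word m} → Rel u v → ∀ (L : List A) → length L ≡ suc m →
    applyWord u L ≡ applyWord v L
  applyWord-Rel (far i j d) L _ with 2≤∣m-n∣⇒far (toℕ i) (toℕ j) d
  ... | inj₁ i+2≤j = sym (swapAdjacent-comm (toℕ i) (toℕ j) L i+2≤j)
  ... | inj₂ j+2≤i = swapAdjacent-comm (toℕ j) (toℕ i) L j+2≤i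
  applyWord-Rel (near i j d) L len with ∣m-n∣≡1⇒adjacent (toℕ i) (toℕ j) d
  ... | inj₁ e rewrite e = swapAdjacent-braid (toℕ i) L (braid-fits j L len e)
  ... | inj₂ e rewrite e = sym (swapAdjacent-braid (toℕ j) L (braid-fits i L len e))

  applyWord-≈ : {u v : Word m} → u ≈ v → ∀ (L : List A) → length L ≡ suc m →
    applyWord u L ≡ applyWord v L
  applyWord-≈ (step a u v b r) L len = begin
    applyWord (a ++ u ++ b) L               ≡⟨ applyWord-++ a (u ++ b) L ⟩
    applyWord (u ++ b) (applyWord a L)      ≡⟨ applyWord-++ u b _ ⟩
    applyWord b (applyWord u (applyWord a L)) ≡⟨ cong (applyWord b) (applyWord-Rel r _ (trans (length-applyWord a L) len)) ⟩
    applyWord b (applyWord v (applyWord a L)) ≡⟨ applyWord-++ v b _ ⟨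
    applyWord (v ++ b) (applyWord a L)      ≡⟨ applyWord-++ a (v ++ b) L ⟨
    applyWord (a ++ v ++ b) L               ∎
    where open ≡-Reasoning
  applyWord-≈ (≈-refl u)    L len = refl
  applyWord-≈ (≈-sym p)     L len = sym (applyWord-≈ p L len)
  applyWord-≈ (≈-trans p q) L len = trans (applyWord-≈ p L len) (applyWord-≈ q L len)

-- Inversions

true≢false : true ≢ false
true≢false ()

bit : Bool → ℕ
bit true  = 1
bit false = 0

bit≤1 : ∀ b → bit b ≤ 1
bit≤1 true  = s≤s z≤n
bit≤1 false = z≤n

≥⇒<ᵇ≡false : ∀ a x → x ≤ a → (a <ᵇ x) ≡ false
≥⇒<ᵇ≡false a       zero    h       = refl
≥⇒<ᵇ≡false (suc a) (suc x) (s≤s h) = ≥⇒<ᵇ≡false a x h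

<⇒<ᵇ≡true : ∀ a x → a < x → (a <ᵇ x) ≡ true
<⇒<ᵇ≡true zero    (suc x) h       = refl
<⇒<ᵇ≡true (suc a) (suc x) (s≤s h) = <⇒<ᵇ≡true a x h

countBelow : ℕ → List ℕ → ℕ
countBelow x []      = 0
countBelow x (y ∷ L) = bit (y <ᵇ x) + countBelow x L

inversions : List ℕ → ℕ
inversions []      = 0
inversions (x ∷ L) = countBelow x L + inversions L

countBelow-swapAdjacent : ∀ x i L → countBelow x (swapAdjacent i L) ≡ countBelow x L
countBelow-swapAdjacent x zero    []          = refl
countBelow-swapAdjacent x zero    (a ∷ [])    = refl
countBelow-swapAdjacent x zero    (a ∷ b ∷ L) = x∙yz≈y∙xz (bit (b <ᵇ x)) (bit (a <ᵇ x)) (countBelow x L)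
countBelow-swapAdjacent x (suc i) []          = refl
countBelow-swapAdjacent x (suc i) (a ∷ L)     = cong (bit (a <ᵇ x) +_) (countBelow-swapAdjacent x i L)

inversions-swapAdjacent : ∀ i L → inversions (swapAdjacent i L) ≤ suc (inversions L)
inversions-swapAdjacent zero    []          = n≤1+n _
inversions-swapAdjacent zero    (a ∷ [])    = n≤1+n _
inversions-swapAdjacent zero    (a ∷ b ∷ L) = begin
  (bit (a <ᵇ b) + countBelow b L) + (countBelow a L + inversions L)
    ≤⟨ +-monoˡ-≤ _ (+-monoˡ-≤ _ (bit≤1 (a <ᵇ b))) ⟩
  suc (countBelow b L + (countBelow a L + inversions L))
    ≡⟨ cong suc (x∙yz≈y∙xz (countBelow b L) (countBelow a L) (inversions L)) ⟩
  suc (countBelow a L + (countBelow b L + inversions L))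
    ≤⟨ s≤s (+-monoˡ-≤ _ (m≤n+m _ (bit (b <ᵇ a)))) ⟩
  suc ((bit (b <ᵇ a) + countBelow a L) + (countBelow b L + inversions L)) ∎
  where open ≤-Reasoning
inversions-swapAdjacent (suc i) []          = n≤1+n _
inversions-swapAdjacent (suc i) (a ∷ L)     = begin
  countBelow a (swapAdjacent i L) + inversions (swapAdjacent i L)
    ≡⟨ cong (_+ inversions (swapAdjacent i L)) (countBelow-swapAdjacent a i L) ⟩
  countBelow a L + inversions (swapAdjacent i L)
    ≤⟨ +-monoʳ-≤ (countBelow a L) (inversions-swapAdjacent i L) ⟩
  countBelow a L + suc (inversions L)
    ≡⟨ +-suc (countBelow a L) (inversions L) ⟩
  suc (countBelow a L + inversions L) ∎
  where open ≤-Reasoning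

inversions-applySwaps : ∀ w L → inversions (applySwaps w L) ≤ inversions L + length w
inversions-applySwaps []      L = ≤-reflexive (sym (+-identityʳ (inversions L)))
inversions-applySwaps (i ∷ w) L = begin
  inversions (applySwaps w (swapAdjacent i L)) ≤⟨ inversions-applySwaps w (swapAdjacent i L) ⟩
  inversions (swapAdjacent i L) + length w     ≤⟨ +-monoˡ-≤ (length w) (inversions-swapAdjacent i L) ⟩
  suc (inversions L) + length w                ≡⟨ +-suc (inversions L) (length w) ⟨
  inversions L + suc (length w)                ∎
  where open ≤-Reasoning

inversions-applyWord : ∀ (w : Word m) L → inversions (applyWord w L) ≤ inversions L + length w
inversions-applyWord w L =
  subst (λ k → inversions (applyWord w L) ≤ inversions L + k) (length-map toℕ w) (inversions-applySwaps (map toℕ w) L)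

range : ℕ → ℕ → List ℕ
range a zero    = []
range a (suc n) = a ∷ range (suc a) n

length-range : ∀ a n → length (range a n) ≡ n
length-range a zero    = refl
length-range a (suc n) = cong suc (length-range (suc a) n)

countBelow-range-≤ : ∀ x a n → x ≤ a → countBelow x (range a n) ≡ 0
countBelow-range-≤ x a zero    h = refl
countBelow-range-≤ x a (suc n) h rewrite ≥⇒<ᵇ≡false a x h = countBelow-range-≤ x (suc a) n (m≤n⇒m≤1+n h)

inversions-range : ∀ a n → inversions (range a n) ≡ 0
inversions-range a zero    = refl
inversions-range a (suc n) = cong₂ _+_ (countBelow-range-≤ a (suc a) n (n≤1+n a)) (inversions-range (suc a) n)

-- The permutation of {0, …, m} underlying a braid word, in one-line notation.
oneLine : Word m → List ℕ
oneLine {m} w = applyWord w (range 0 (suc m))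

length-oneLine : (w : Word m) → length (oneLine w) ≡ suc m
length-oneLine {m} w = trans (length-applyWord w (range 0 (suc m))) (length-range 0 (suc m))

inversions-oneLine≤length : (w : Word m) → inversions (oneLine w) ≤ length w
inversions-oneLine≤length {m} w =
  subst (λ k → inversions (oneLine w) ≤ k + length w) (inversions-range 0 (suc m)) (inversions-applyWord w (range 0 (suc m)))

oneLine-≈ : {u v : Word m} → u ≈ v → oneLine u ≡ oneLine v
oneLine-≈ {m} h = applyWord-≈ h (range 0 (suc m)) (length-range 0 (suc m))

oneLine-snoc : (w : Word m) (i : Fin m) → oneLine (w ++ [ i ]) ≡ swapAdjacent (toℕ i) (oneLine w)
oneLine-snoc {m} w i = applyWord-++ w [ i ] (range 0 (suc m))

-- The half twist Δ

applySwaps-map-suc : {A : Set} → ∀ ns (y : A) L → applySwaps (map suc ns) (y ∷ L) ≡ y ∷ applySwaps ns L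
applySwaps-map-suc []       y L = refl
applySwaps-map-suc (i ∷ ns) y L = applySwaps-map-suc ns y (swapAdjacent i L)

applyWord-map-suc : {A : Set} → ∀ (w : Word m) (y : A) L → applyWord (map suc w) (y ∷ L) ≡ y ∷ applyWord w L
applyWord-map-suc w y L =
  trans (cong (λ z → applySwaps z (y ∷ L)) (trans (sym (map-∘ w)) (map-∘ w))) (applySwaps-map-suc (map toℕ w) y L)

applyWord-map-inject₁ : {A : Set} → (w : Word m) (L : List A) → applyWord (map inject₁ w) L ≡ applyWord w L
applyWord-map-inject₁ w L = cong (λ z → applySwaps z L) (trans (sym (map-∘ w)) (map-cong toℕ-inject₁ w))

range-suc : ∀ a n → range (suc a) n ≡ map suc (range a n)
range-suc a zero    = refl
range-suc a (suc n) = cong (suc a ∷_) (range-suc (suc a) n)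

range-snoc : ∀ a n → range a (suc n) ≡ range a n ++ [ a + n ]
range-snoc a zero    = cong [_] (sym (+-identityʳ a))
range-snoc a (suc n) = cong (a ∷_)
  (trans (range-snoc (suc a) n) (cong (λ z → range (suc a) n ++ [ z ]) (sym (+-suc a n))))

tabulate-range : ∀ n a (f : ℕ → ℕ) → tabulate {n = n} (λ i → f (a + toℕ i)) ≡ map f (range a n)
tabulate-range zero    a f = refl
tabulate-range (suc n) a f = cong₂ _∷_ (cong f (+-identityʳ a))
  (trans (tabulate-cong (λ i → cong f (+-suc a (toℕ i)))) (tabulate-range n (suc a) f))

tabulate-toℕ : ∀ n (f : ℕ → ℕ) → tabulate {n = n} (λ i → f (toℕ i)) ≡ map f (range 0 n)
tabulate-toℕ n = tabulate-range n 0

map-toℕ-allFin : ∀ n → map toℕ (allFin n) ≡ range 0 n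
map-toℕ-allFin n = trans (map-tabulate (λ t → t) toℕ) (trans (tabulate-toℕ n (λ x → x)) (map-id (range 0 n)))

applySwaps-rotate : {A : Set} → ∀ k (a : A) L → length L ≡ k → applySwaps (range 0 k) (a ∷ L) ≡ L ++ [ a ]
applySwaps-rotate zero    a []      refl = refl
applySwaps-rotate (suc k) a (b ∷ L) h    = begin
  applySwaps (range 0 (suc k)) (a ∷ b ∷ L)     ≡⟨⟩
  applySwaps (range 1 k) (b ∷ a ∷ L)           ≡⟨ cong (λ z → applySwaps z (b ∷ a ∷ L)) (range-suc 0 k) ⟩
  applySwaps (map suc (range 0 k)) (b ∷ a ∷ L) ≡⟨ applySwaps-map-suc (range 0 k) b (a ∷ L) ⟩
  b ∷ applySwaps (range 0 k) (a ∷ L)           ≡⟨ cong (b ∷_) (applySwaps-rotate k a L (suc-injective h)) ⟩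
  b ∷ L ++ [ a ]                               ∎
  where open ≡-Reasoning

swapAdjacent-snoc : {A : Set} → ∀ i (L : List A) x → suc i < length L →
  swapAdjacent i (L ++ [ x ]) ≡ swapAdjacent i L ++ [ x ]
swapAdjacent-snoc zero    (a ∷ [])    x (s≤s ())
swapAdjacent-snoc zero    (a ∷ b ∷ L) x h       = refl
swapAdjacent-snoc (suc i) (a ∷ L)     x (s≤s h) = cong (a ∷_) (swapAdjacent-snoc i L x h)

applyWord-snoc : {A : Set} → ∀ (w : Word m) (L : List A) x → length L ≡ suc m →
  applyWord w (L ++ [ x ]) ≡ applyWord w L ++ [ x ]
applyWord-snoc []      L x h = refl
applyWord-snoc (i ∷ w) L x h = trans
  (cong (applyWord w) (swapAdjacent-snoc (toℕ i) L x (subst (suc (toℕ i) <_) (sym h) (s≤s (toℕ<n i)))))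
  (applyWord-snoc w (swapAdjacent (toℕ i) L) x (trans (length-swapAdjacent (toℕ i) L) h))

applyWord-Δ : {A : Set} → ∀ m (L : List A) → length L ≡ suc m → applyWord (Δ m) L ≡ reverse L
applyWord-Δ zero    (a ∷ []) refl = refl
applyWord-Δ (suc m) (a ∷ L)  h    = begin
  applyWord (Δ (suc m)) (a ∷ L)
    ≡⟨ applyWord-++ (allFin (suc m)) (map inject₁ (Δ m)) (a ∷ L) ⟩
  applyWord (map inject₁ (Δ m)) (applyWord (allFin (suc m)) (a ∷ L))
    ≡⟨ cong (λ z → applyWord (map inject₁ (Δ m)) (applySwaps z (a ∷ L))) (map-toℕ-allFin (suc m)) ⟩
  applyWord (map inject₁ (Δ m)) (applySwaps (range 0 (suc m)) (a ∷ L))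
    ≡⟨ cong (applyWord (map inject₁ (Δ m))) (applySwaps-rotate (suc m) a L (suc-injective h)) ⟩
  applyWord (map inject₁ (Δ m)) (L ++ [ a ])                   ≡⟨ applyWord-map-inject₁ (Δ m) (L ++ [ a ]) ⟩
  applyWord (Δ m) (L ++ [ a ])                                 ≡⟨ applyWord-snoc (Δ m) L a (suc-injective h) ⟩
  applyWord (Δ m) L ++ [ a ]                                   ≡⟨ cong (_++ [ a ]) (applyWord-Δ m L (suc-injective h)) ⟩
  reverse L ++ [ a ]                                           ≡⟨ unfold-reverse a L ⟨
  reverse (a ∷ L)                                              ∎
  where open ≡-Reasoning

triangle : ℕ → ℕ
triangle zero    = 0
triangle (suc m) = suc m + triangle m

length-Δ : ∀ m → length (Δ m) ≡ triangle m
length-Δ zero    = refl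
length-Δ (suc m) = trans (length-++ (allFin (suc m)))
  (cong₂ _+_ (length-tabulate (λ t → t)) (trans (length-map inject₁ (Δ m)) (length-Δ m)))

countBelow-++ : ∀ x L L′ → countBelow x (L ++ L′) ≡ countBelow x L + countBelow x L′
countBelow-++ x []      L′ = refl
countBelow-++ x (y ∷ L) L′ =
  trans (cong (bit (y <ᵇ x) +_) (countBelow-++ x L L′)) (sym (+-assoc (bit (y <ᵇ x)) (countBelow x L) (countBelow x L′)))

countBelow-reverse : ∀ x L → countBelow x (reverse L) ≡ countBelow x L
countBelow-reverse x []      = refl
countBelow-reverse x (y ∷ L) = begin
  countBelow x (reverse (y ∷ L))                  ≡⟨ cong (countBelow x) (unfold-reverse y L) ⟩
  countBelow x (reverse L ++ [ y ])               ≡⟨ countBelow-++ x (reverse L) [ y ] ⟩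
  countBelow x (reverse L) + (bit (y <ᵇ x) + 0)   ≡⟨ cong₂ _+_ (countBelow-reverse x L) (+-identityʳ _) ⟩
  countBelow x L + bit (y <ᵇ x)                   ≡⟨ +-comm (countBelow x L) _ ⟩
  bit (y <ᵇ x) + countBelow x L                   ∎
  where open ≡-Reasoning

countBelow-range : ∀ x a n → a + n ≤ x → countBelow x (range a n) ≡ n
countBelow-range x a zero    h = refl
countBelow-range x a (suc n) h
  rewrite <⇒<ᵇ≡true a x (≤-trans (s≤s (m≤m+n a n)) (subst (_≤ x) (+-suc a n) h)) =
  cong suc (countBelow-range x (suc a) n (subst (_≤ x) (+-suc a n) h))

inversions-reverse-range : ∀ n → inversions (reverse (range 0 (suc n))) ≡ triangle n
inversions-reverse-range zero    = refl
inversions-reverse-range (suc n) = begin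
  inversions (reverse (range 0 (suc (suc n))))
    ≡⟨ cong (λ z → inversions (reverse z)) (range-snoc 0 (suc n)) ⟩
  inversions (reverse (range 0 (suc n) ++ [ suc n ]))
    ≡⟨ cong inversions (reverse-++ (range 0 (suc n)) [ suc n ]) ⟩
  countBelow (suc n) (reverse (range 0 (suc n))) + inversions (reverse (range 0 (suc n)))
    ≡⟨ cong₂ _+_ (trans (countBelow-reverse (suc n) (range 0 (suc n))) (countBelow-range (suc n) 0 (suc n) ≤-refl))
                 (inversions-reverse-range n) ⟩
  suc n + triangle n ∎
  where open ≡-Reasoning

inversions-oneLine-Δ : ∀ m → inversions (oneLine (Δ m)) ≡ triangle m
inversions-oneLine-Δ m =
  trans (cong inversions (applyWord-Δ m (range 0 (suc m)) (length-range 0 (suc m)))) (inversions-reverse-range m)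

-- Codes: a normal form for simple braids

-- A code (p₁, …, pₘ) with pₖ ≤ k describes the permutation of {0, …, m} obtained from [0] by inserting
-- 1, 2, …, m successively at positions p₁, p₂, …, pₘ; codeWord c is a reduced word for it.
Code : ℕ → Set
Code zero    = ⊤
Code (suc m) = Code m × Fin (suc (suc m))

-- σ_m ⋯ σ_{p+1}: moves the last entry of a list of length m+1 to position p.
insertionWord : (m : ℕ) → Fin (suc m) → Word m
insertionWord zero    zero    = []
insertionWord (suc m) zero    = map suc (insertionWord m zero) ++ [ zero ]
insertionWord (suc m) (suc p) = map suc (insertionWord m p)

codeWord : (m : ℕ) → Code m → Word m
codeWord zero    tt      = []
codeWord (suc m) (c , p) = map inject₁ (codeWord m c) ++ insertionWord (suc m) p

insertionWord-inject₁ʳ : ∀ m (i : Fin (suc m)) →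
  insertionWord (suc m) (inject₁ i) ≡ insertionWord (suc m) (suc i) ++ [ i ]
insertionWord-inject₁ʳ zero    zero    = refl
insertionWord-inject₁ʳ (suc m) zero    = refl
insertionWord-inject₁ʳ (suc m) (suc i) =
  trans (cong (map suc) (insertionWord-inject₁ʳ m i)) (map-++ suc (insertionWord (suc m) (suc i)) [ i ])

insertionWord-inject₁ˡ : ∀ m (p : Fin (suc m)) →
  insertionWord (suc m) (inject₁ p) ≡ fromℕ m ∷ map inject₁ (insertionWord m p)
insertionWord-inject₁ˡ zero    zero    = refl
insertionWord-inject₁ˡ (suc m) zero    = begin
  map suc (insertionWord (suc m) (inject₁ zero)) ++ [ zero ]
    ≡⟨ cong (λ z → map suc z ++ [ zero ]) (insertionWord-inject₁ˡ m zero) ⟩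
  suc (fromℕ m) ∷ map suc (map inject₁ (insertionWord m zero)) ++ [ zero ]
    ≡⟨ cong (λ z → suc (fromℕ m) ∷ z ++ [ zero ])
            (trans (sym (map-∘ (insertionWord m zero))) (map-∘ (insertionWord m zero))) ⟩
  suc (fromℕ m) ∷ map inject₁ (map suc (insertionWord m zero)) ++ [ zero ]
    ≡⟨ cong (suc (fromℕ m) ∷_) (map-++ inject₁ (map suc (insertionWord m zero)) [ zero ]) ⟨
  suc (fromℕ m) ∷ map inject₁ (map suc (insertionWord m zero) ++ [ zero ]) ∎
  where open ≡-Reasoning
insertionWord-inject₁ˡ (suc m) (suc p) = trans (cong (map suc) (insertionWord-inject₁ˡ m p))
  (cong (suc (fromℕ m) ∷_) (trans (sym (map-∘ (insertionWord m p))) (map-∘ (insertionWord m p))))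

length-insertionWord : ∀ m (p : Fin (suc m)) → length (insertionWord m p) ≡ m ∸ toℕ p
length-insertionWord zero    zero    = refl
length-insertionWord (suc m) zero    = trans (length-++ (map suc (insertionWord m zero)))
  (trans (cong (_+ 1) (trans (length-map suc (insertionWord m zero)) (length-insertionWord m zero))) (+-comm m 1))
length-insertionWord (suc m) (suc p) = trans (length-map suc (insertionWord m p)) (length-insertionWord m p)

insertionWord-≥ : ∀ m (p : Fin (suc m)) → All (λ t → toℕ p ≤ toℕ t) (insertionWord m p)
insertionWord-≥ zero    zero    = []
insertionWord-≥ (suc m) zero    = All.universal (λ _ → z≤n) _
insertionWord-≥ (suc m) (suc p) = map⁺ (All.map s≤s (insertionWord-≥ m p))

insertionWord-comm-far : ∀ m (p : Fin (suc (suc m))) (i : Fin m) → toℕ i + 2 ≤ toℕ p →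
  (insertionWord (suc m) p ++ [ inject₁ i ]) ≈ (inject₁ i ∷ insertionWord (suc m) p)
insertionWord-comm-far m p i h = FarFrom-comm (inject₁ i) (insertionWord (suc m) p)
  (FarFrom-if-above (inject₁ i) (insertionWord (suc m) p)
    (subst (λ z → z + 2 ≤ toℕ p) (sym (toℕ-inject₁ i)) h) (insertionWord-≥ (suc m) p))

-- The only use of a braid relation σᵢσᵢ₊₁σᵢ = σᵢ₊₁σᵢσᵢ₊₁; all other cases lift it by map suc.
insertionWord-braid : ∀ m → (insertionWord (suc (suc m)) zero ++ [ suc zero ]) ≈ (zero ∷ insertionWord (suc (suc m)) zero)
insertionWord-braid m = begin
  (map suc (map suc R ++ [ zero ]) ++ [ zero ]) ++ [ suc zero ]
    ≡⟨ ++-assoc (map suc (map suc R ++ [ zero ])) [ zero ] [ suc zero ] ⟩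
  map suc (map suc R ++ [ zero ]) ++ zero ∷ suc zero ∷ []
    ≡⟨ cong (_++ zero ∷ suc zero ∷ []) (map-++ suc (map suc R) [ zero ]) ⟩
  (W ++ [ suc zero ]) ++ zero ∷ suc zero ∷ []
    ≡⟨ ++-assoc W [ suc zero ] (zero ∷ suc zero ∷ []) ⟩
  W ++ suc zero ∷ zero ∷ suc zero ∷ []
    ≈⟨ step W (suc zero ∷ zero ∷ suc zero ∷ []) (zero ∷ suc zero ∷ zero ∷ []) [] (near (suc zero) zero refl) ⟩
  W ++ zero ∷ suc zero ∷ zero ∷ []
    ≡⟨ ++-assoc W [ zero ] (suc zero ∷ zero ∷ []) ⟨
  (W ++ [ zero ]) ++ suc zero ∷ zero ∷ []
    ≈⟨ ++-congʳ (suc zero ∷ zero ∷ []) (FarFrom-comm zero W W-far) ⟩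
  zero ∷ W ++ suc zero ∷ zero ∷ []
    ≡⟨ cong (zero ∷_) (++-assoc W [ suc zero ] [ zero ]) ⟨
  zero ∷ (W ++ [ suc zero ]) ++ [ zero ]
    ≡⟨ cong (λ z → zero ∷ z ++ [ zero ]) (map-++ suc (map suc R) [ zero ]) ⟨
  zero ∷ map suc (map suc R ++ [ zero ]) ++ [ zero ] ∎
  where
  open ≈-Reasoning
  R = insertionWord m zero
  W = map suc (map suc R)
  W-far : FarFrom zero W
  W-far = FarFrom-if-above zero W ≤-refl (map⁺ (map⁺ (All.universal (λ _ → s≤s (s≤s z≤n)) _)))
insertionWord-shift : ∀ m (p : Fin (suc (suc m))) (j : Fin m) → toℕ p ≤ toℕ j →
  (insertionWord (suc m) p ++ [ suc j ]) ≈ (inject₁ j ∷ insertionWord (suc m) p)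
insertionWord-shift (suc m) (suc p) (suc j) (s≤s h) =
  subst₂ _≈_ (map-++ suc (insertionWord (suc m) p) [ suc j ]) refl (≈-map-suc (insertionWord-shift m p j h))
insertionWord-shift (suc m) zero zero h = insertionWord-braid m
insertionWord-shift (suc m) zero (suc j) h = begin
  (map suc R ++ [ zero ]) ++ [ suc (suc j) ]
    ≡⟨ ++-assoc (map suc R) [ zero ] [ suc (suc j) ] ⟩
  map suc R ++ zero ∷ suc (suc j) ∷ []
    ≈⟨ ++-congˡ (map suc R) (step [] (zero ∷ suc (suc j) ∷ []) (suc (suc j) ∷ zero ∷ []) []
                                   (far zero (suc (suc j)) (s≤s (s≤s z≤n)))) ⟩
  map suc R ++ suc (suc j) ∷ zero ∷ []
    ≡⟨ ++-assoc (map suc R) [ suc (suc j) ] [ zero ] ⟨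
  (map suc R ++ [ suc (suc j) ]) ++ [ zero ]
    ≡⟨ cong (_++ [ zero ]) (map-++ suc R [ suc j ]) ⟨
  map suc (R ++ [ suc j ]) ++ [ zero ]
    ≈⟨ ++-congʳ [ zero ] (≈-map-suc (insertionWord-shift m zero j z≤n)) ⟩
  suc (inject₁ j) ∷ map suc R ++ [ zero ] ∎
  where
  open ≈-Reasoning
  R = insertionWord (suc m) zero

insertionWord-shift-all : ∀ m (p : Fin (suc (suc m))) (w : Word m) → All (λ t → toℕ p ≤ toℕ t) w →
  (insertionWord (suc m) p ++ map suc w) ≈ (map inject₁ w ++ insertionWord (suc m) p)
insertionWord-shift-all m p []      []       = ≡⇒≈ (++-identityʳ _)
insertionWord-shift-all m p (t ∷ w) (h ∷ hs) = begin
  insertionWord (suc m) p ++ suc t ∷ map suc w      ≡⟨ ++-assoc (insertionWord (suc m) p) [ suc t ] (map suc w) ⟨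
  (insertionWord (suc m) p ++ [ suc t ]) ++ map suc w ≈⟨ ++-congʳ (map suc w) (insertionWord-shift m p t h) ⟩
  inject₁ t ∷ insertionWord (suc m) p ++ map suc w  ≈⟨ ++-congˡ [ inject₁ t ] (insertionWord-shift-all m p w hs) ⟩
  inject₁ t ∷ map inject₁ w ++ insertionWord (suc m) p ∎
  where open ≈-Reasoning

data RightView {m : ℕ} (i : Fin (suc m)) (p : Fin (suc (suc m))) : Set where
  just-below : p ≡ suc i → RightView i p
  at         : p ≡ inject₁ i → RightView i p
  below      : (i′ : Fin m) → i ≡ inject₁ i′ → toℕ i′ + 2 ≤ toℕ p → RightView i p
  above      : (j : Fin m) → i ≡ suc j → toℕ p ≤ toℕ j → RightView i p

rightView : ∀ {m} (i : Fin (suc m)) (p : Fin (suc (suc m))) → RightView i p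
rightView         zero    zero          = at refl
rightView         zero    (suc zero)    = just-below refl
rightView {suc m} zero    (suc (suc p)) = below zero refl (s≤s (s≤s z≤n))
rightView {suc m} (suc j) zero          = above j refl z≤n
rightView {suc m} (suc j) (suc p) with rightView {m} j p
... | just-below e = just-below (cong suc e)
... | at e         = at (cong suc e)
... | below i′ e b = below (suc i′) (cong suc e) (s≤s b)
... | above j′ e b = above (suc j′) (cong suc e) (s≤s b)

-- How the right descents f of a permutation change when a new maximum is inserted at position p.
insertedDescent : ℕ → ℕ → (ℕ → Bool) → Bool
insertedDescent zero    zero          f = true
insertedDescent zero    (suc zero)    f = false
insertedDescent zero    (suc (suc p)) f = f zero
insertedDescent (suc j) zero          f = f j
insertedDescent (suc j) (suc p)       f = insertedDescent j p (λ k → f (suc k))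

isRightDescent : (m : ℕ) → Code m → ℕ → Bool
isRightDescent zero    tt      j = false
isRightDescent (suc m) (c , p) j = insertedDescent j (toℕ p) (isRightDescent m c)

insertedDescent-just-below : ∀ j f → insertedDescent j (suc j) f ≡ false
insertedDescent-just-below zero    f = refl
insertedDescent-just-below (suc j) f = insertedDescent-just-below j _

insertedDescent-at : ∀ j f → insertedDescent j j f ≡ true
insertedDescent-at zero    f = refl
insertedDescent-at (suc j) f = insertedDescent-at j _

insertedDescent-below : ∀ i p f → i + 2 ≤ p → insertedDescent i p f ≡ f i
insertedDescent-below zero    (suc zero)    f (s≤s ())
insertedDescent-below zero    (suc (suc p)) f h       = refl
insertedDescent-below (suc i) (suc p)       f (s≤s h) = insertedDescent-below i p (λ k → f (suc k)) h

insertedDescent-above : ∀ p j f → p ≤ j → insertedDescent (suc j) p f ≡ f j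
insertedDescent-above zero    j       f h       = refl
insertedDescent-above (suc p) (suc j) f (s≤s h) = insertedDescent-above p j (λ k → f (suc k)) h

data RightMul (m : ℕ) (c : Code m) (i : Fin m) : Set where
  ascent  : (c′ : Code m) → (codeWord m c ++ [ i ]) ≈ codeWord m c′ →
            isRightDescent m c (toℕ i) ≡ false → RightMul m c i
  descent : (c′ : Code m) → codeWord m c ≈ (codeWord m c′ ++ [ i ]) →
            isRightDescent m c (toℕ i) ≡ true → RightMul m c i

commute-past-insertion : ∀ m (p : Fin (suc (suc m))) (u : Word m) {x : Fin (suc m)} {y : Fin m} →
  (insertionWord (suc m) p ++ [ x ]) ≈ (inject₁ y ∷ insertionWord (suc m) p) →
  ((map inject₁ u ++ insertionWord (suc m) p) ++ [ x ]) ≈ (map inject₁ (u ++ [ y ]) ++ insertionWord (suc m) p)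
commute-past-insertion m p u {x} {y} h = begin
  (map inject₁ u ++ R) ++ [ x ]         ≡⟨ ++-assoc (map inject₁ u) R [ x ] ⟩
  map inject₁ u ++ R ++ [ x ]           ≈⟨ ++-congˡ (map inject₁ u) h ⟩
  map inject₁ u ++ inject₁ y ∷ R        ≡⟨ ++-assoc (map inject₁ u) [ inject₁ y ] R ⟨
  (map inject₁ u ++ [ inject₁ y ]) ++ R ≡⟨ cong (_++ R) (map-++ inject₁ u [ y ]) ⟨
  map inject₁ (u ++ [ y ]) ++ R         ∎
  where
  open ≈-Reasoning
  R = insertionWord (suc m) p

rightMul-lift : ∀ m c (p : Fin (suc (suc m))) {x : Fin (suc m)} {y : Fin m} → RightMul m c y →
  (insertionWord (suc m) p ++ [ x ]) ≈ (inject₁ y ∷ insertionWord (suc m) p) →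
  isRightDescent (suc m) (c , p) (toℕ x) ≡ isRightDescent m c (toℕ y) → RightMul (suc m) (c , p) x
rightMul-lift m c p (ascent c′ h r) comm e =
  ascent (c′ , p) (≈-trans (commute-past-insertion m p (codeWord m c) comm)
                           (++-congʳ (insertionWord (suc m) p) (≈-map-inject₁ h))) (trans e r)
rightMul-lift m c p (descent c′ h r) comm e =
  descent (c′ , p) (≈-trans (++-congʳ (insertionWord (suc m) p) (≈-map-inject₁ h))
                            (≈-sym (commute-past-insertion m p (codeWord m c′) comm))) (trans e r)

rightMul : ∀ m (c : Code m) (i : Fin m) → RightMul m c i
rightMul (suc m) (c , p) i with rightView i p
... | just-below refl = ascent (c , inject₁ i)
  (≡⇒≈ (trans (++-assoc (map inject₁ (codeWord m c)) (insertionWord (suc m) (suc i)) [ i ])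
              (cong (map inject₁ (codeWord m c) ++_) (sym (insertionWord-inject₁ʳ m i)))))
  (insertedDescent-just-below (toℕ i) _)
... | at refl = descent (c , suc i)
  (≡⇒≈ (trans (cong (map inject₁ (codeWord m c) ++_) (insertionWord-inject₁ʳ m i))
              (sym (++-assoc (map inject₁ (codeWord m c)) (insertionWord (suc m) (suc i)) [ i ]))))
  (trans (cong (λ z → insertedDescent (toℕ i) z (isRightDescent m c)) (toℕ-inject₁ i)) (insertedDescent-at (toℕ i) _))
... | below i′ refl b = rightMul-lift m c p (rightMul m c i′) (insertionWord-comm-far m p i′ b)
  (trans (insertedDescent-below (toℕ (inject₁ i′)) (toℕ p) (isRightDescent m c)
           (subst (λ z → z + 2 ≤ toℕ p) (sym (toℕ-inject₁ i′)) b))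
         (cong (isRightDescent m c) (toℕ-inject₁ i′)))
... | above j refl b = rightMul-lift m c p (rightMul m c j) (insertionWord-shift m p j b)
  (insertedDescent-above (toℕ p) (toℕ j) (isRightDescent m c) b)

positionOfMax : (m : ℕ) → Code m → ℕ
positionOfMax zero    tt      = 0
positionOfMax (suc m) (c , p) = toℕ p

-- σ_{i+1} is a left descent iff the value i+1 stands to the left of the value i.
isLeftDescent : (m : ℕ) → Code m → ℕ → Bool
isLeftDescent zero    tt      i = false
isLeftDescent (suc m) (c , p) i = if i ≡ᵇ m then toℕ p ≤ᵇ positionOfMax m c else isLeftDescent m c i

≡ᵇ-refl : ∀ m → (m ≡ᵇ m) ≡ true
≡ᵇ-refl zero    = refl
≡ᵇ-refl (suc m) = ≡ᵇ-refl m

<⇒≡ᵇ≡false : ∀ i m → i < m → (i ≡ᵇ m) ≡ false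
<⇒≡ᵇ≡false zero    (suc m) h       = refl
<⇒≡ᵇ≡false (suc i) (suc m) (s≤s h) = <⇒≡ᵇ≡false i m h

≤⇒≤ᵇ≡true : ∀ a b → a ≤ b → (a ≤ᵇ b) ≡ true
≤⇒≤ᵇ≡true zero    b h = refl
≤⇒≤ᵇ≡true (suc a) b h = <⇒<ᵇ≡true a b h

≰⇒≤ᵇ≡false : ∀ a b → ¬ (a ≤ b) → (a ≤ᵇ b) ≡ false
≰⇒≤ᵇ≡false zero    b h = ⊥-elim (h z≤n)
≰⇒≤ᵇ≡false (suc a) b h = ≥⇒<ᵇ≡false a b (≤-pred (≰⇒> h))

isLeftDescent-last : ∀ m (c : Code m) p → isLeftDescent (suc m) (c , p) m ≡ (toℕ p ≤ᵇ positionOfMax m c)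
isLeftDescent-last m c p rewrite ≡ᵇ-refl m = refl

isLeftDescent-< : ∀ m (c : Code m) p i → i < m → isLeftDescent (suc m) (c , p) i ≡ isLeftDescent m c i
isLeftDescent-< m c p i i<m rewrite <⇒≡ᵇ≡false i m i<m = refl

isLeftDescent-inject₁ : ∀ m (c : Code m) p (i : Fin m) →
  isLeftDescent (suc m) (c , p) (toℕ (inject₁ i)) ≡ isLeftDescent m c (toℕ i)
isLeftDescent-inject₁ m c p i =
  trans (cong (isLeftDescent (suc m) (c , p)) (toℕ-inject₁ i)) (isLeftDescent-< m c p (toℕ i) (toℕ<n i))

fromℕ-or-inject₁ : ∀ {m} (i : Fin (suc m)) → (i ≡ fromℕ m) ⊎ Σ (Fin m) (λ i′ → i ≡ inject₁ i′)
fromℕ-or-inject₁ {zero}  zero    = inj₁ refl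
fromℕ-or-inject₁ {suc m} zero    = inj₂ (zero , refl)
fromℕ-or-inject₁ {suc m} (suc i) with fromℕ-or-inject₁ {m} i
... | inj₁ e        = inj₁ (cong suc e)
... | inj₂ (i′ , e) = inj₂ (suc i′ , cong suc e)

data LeftMul (m : ℕ) (c : Code m) (i : Fin m) : Set where
  ascent  : (c′ : Code m) → (i ∷ codeWord m c) ≈ codeWord m c′ →
            isLeftDescent m c (toℕ i) ≡ false → LeftMul m c i
  descent : (c′ : Code m) → codeWord m c ≈ (i ∷ codeWord m c′) →
            isLeftDescent m c (toℕ i) ≡ true → LeftMul m c i

FarFrom-fromℕ : ∀ m (w : Word m) → FarFrom (fromℕ (suc m)) (map inject₁ (map inject₁ w))
FarFrom-fromℕ m w = FarFrom-if-below (fromℕ (suc m)) _ (map⁺ (map⁺ (All.universal x+2≤top w)))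
  where
  x+2≤top : (x : Fin m) → toℕ (inject₁ (inject₁ x)) + 2 ≤ toℕ (fromℕ (suc m))
  x+2≤top x rewrite toℕ-inject₁ (inject₁ x) | toℕ-inject₁ x | toℕ-fromℕ (suc m) =
    subst (_≤ suc m) (+-comm 2 (toℕ x)) (s≤s (toℕ<n x))

-- σ_{m+2} commutes past the letters of the first m insertions, and the last two insertion words
-- exchange their roles.
codeWord≈fromℕ∷codeWord : ∀ m (c : Code m) (t p̂ : Fin (suc (suc m))) (p : Fin (suc (suc (suc m)))) →
  inject₁ p̂ ≡ p → toℕ p ≤ toℕ t →
  codeWord (suc (suc m)) ((c , t) , p) ≈ (fromℕ (suc m) ∷ codeWord (suc (suc m)) ((c , p̂) , suc t))
codeWord≈fromℕ∷codeWord m c t p̂ p p̂≡p p≤t = begin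
  map inject₁ (map inject₁ (codeWord m c) ++ Rt) ++ insertionWord (suc (suc m)) p
    ≡⟨ cong (_++ insertionWord (suc (suc m)) p) (map-++ inject₁ (map inject₁ (codeWord m c)) Rt) ⟩
  (W ++ map inject₁ Rt) ++ insertionWord (suc (suc m)) p
    ≡⟨ ++-assoc W (map inject₁ Rt) (insertionWord (suc (suc m)) p) ⟩
  W ++ map inject₁ Rt ++ insertionWord (suc (suc m)) p
    ≈⟨ ++-congˡ W (insertionWord-shift-all (suc m) p Rt (All.map (≤-trans p≤t) (insertionWord-≥ (suc m) t))) ⟨
  W ++ insertionWord (suc (suc m)) p ++ map suc Rt
    ≡⟨ cong (λ z → W ++ insertionWord (suc (suc m)) z ++ map suc Rt) p̂≡p ⟨
  W ++ insertionWord (suc (suc m)) (inject₁ p̂) ++ map suc Rt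
    ≡⟨ cong (λ z → W ++ z ++ map suc Rt) (insertionWord-inject₁ˡ (suc m) p̂) ⟩
  W ++ top ∷ Rp̂ ++ map suc Rt
    ≡⟨ ++-assoc W [ top ] _ ⟨
  (W ++ [ top ]) ++ Rp̂ ++ map suc Rt
    ≈⟨ ++-congʳ _ (FarFrom-comm top W (FarFrom-fromℕ m (codeWord m c))) ⟩
  top ∷ W ++ Rp̂ ++ map suc Rt
    ≡⟨ cong (top ∷_) (++-assoc W Rp̂ (map suc Rt)) ⟨
  top ∷ (W ++ Rp̂) ++ map suc Rt
    ≡⟨ cong (λ z → top ∷ z ++ map suc Rt) (map-++ inject₁ (map inject₁ (codeWord m c)) (insertionWord (suc m) p̂)) ⟨
  top ∷ map inject₁ (map inject₁ (codeWord m c) ++ insertionWord (suc m) p̂) ++ map suc Rt ∎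
  where
  open ≈-Reasoning
  W = map inject₁ (map inject₁ (codeWord m c))
  Rt = insertionWord (suc m) t
  Rp̂ = map inject₁ (insertionWord (suc m) p̂)
  top = fromℕ (suc m)

fromℕ∷codeWord≈codeWord : ∀ m (c : Code m) (t p : Fin (suc (suc m))) → toℕ (inject₁ t) ≤ toℕ p →
  (fromℕ (suc m) ∷ codeWord (suc (suc m)) ((c , t) , suc p)) ≈ codeWord (suc (suc m)) ((c , p) , inject₁ t)
fromℕ∷codeWord≈codeWord m c t p t≤p = begin
  top ∷ map inject₁ (map inject₁ (codeWord m c) ++ insertionWord (suc m) t) ++ map suc Rp
    ≡⟨ cong (λ z → top ∷ z ++ map suc Rp) (map-++ inject₁ (map inject₁ (codeWord m c)) (insertionWord (suc m) t)) ⟩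
  top ∷ (W ++ Rt) ++ map suc Rp
    ≡⟨ cong (top ∷_) (++-assoc W Rt (map suc Rp)) ⟩
  top ∷ W ++ Rt ++ map suc Rp
    ≈⟨ ++-congʳ _ (FarFrom-comm top W (FarFrom-fromℕ m (codeWord m c))) ⟨
  (W ++ [ top ]) ++ Rt ++ map suc Rp
    ≡⟨ ++-assoc W [ top ] _ ⟩
  W ++ top ∷ Rt ++ map suc Rp
    ≡⟨ cong (λ z → W ++ z ++ map suc Rp) (insertionWord-inject₁ˡ (suc m) t) ⟨
  W ++ insertionWord (suc (suc m)) (inject₁ t) ++ map suc Rp
    ≈⟨ ++-congˡ W (insertionWord-shift-all (suc m) (inject₁ t) Rp (All.map (≤-trans t≤p) (insertionWord-≥ (suc m) p))) ⟩
  W ++ map inject₁ Rp ++ insertionWord (suc (suc m)) (inject₁ t)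
    ≡⟨ ++-assoc W (map inject₁ Rp) _ ⟨
  (W ++ map inject₁ Rp) ++ insertionWord (suc (suc m)) (inject₁ t)
    ≡⟨ cong (_++ insertionWord (suc (suc m)) (inject₁ t)) (map-++ inject₁ (map inject₁ (codeWord m c)) Rp) ⟨
  map inject₁ (map inject₁ (codeWord m c) ++ Rp) ++ insertionWord (suc (suc m)) (inject₁ t) ∎
  where
  open ≈-Reasoning
  W = map inject₁ (map inject₁ (codeWord m c))
  Rp = insertionWord (suc m) p
  Rt = map inject₁ (insertionWord (suc m) t)
  top = fromℕ (suc m)

leftMul-fromℕ : ∀ m (c : Code m) (p : Fin (suc (suc m))) → LeftMul (suc m) (c , p) (fromℕ m)
leftMul-fromℕ zero    tt       zero       = descent (tt , suc zero) (≈-refl _) refl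
leftMul-fromℕ zero    tt       (suc zero) = ascent (tt , zero) (≈-refl _) refl
leftMul-fromℕ (suc m) (c , t) p with toℕ p ≤? toℕ t
... | yes p≤t = descent ((c , lower₁ p p≢) , suc t)
  (codeWord≈fromℕ∷codeWord m c t (lower₁ p p≢) p (inject₁-lower₁ p p≢) p≤t)
  (trans (cong (isLeftDescent (suc (suc m)) ((c , t) , p)) (toℕ-fromℕ (suc m)))
         (trans (isLeftDescent-last (suc m) (c , t) p) (≤⇒≤ᵇ≡true _ _ p≤t)))
  where
  p≢ : suc (suc m) ≢ toℕ p
  p≢ = >⇒≢ (≤-trans (s≤s p≤t) (toℕ<n t))
leftMul-fromℕ (suc m) (c , t) zero    | no p≰t = ⊥-elim (p≰t z≤n)
leftMul-fromℕ (suc m) (c , t) (suc p) | no p≰t = ascent ((c , p) , inject₁ t)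
  (fromℕ∷codeWord≈codeWord m c t p (subst (_≤ toℕ p) (sym (toℕ-inject₁ t)) (≤-pred (≰⇒> p≰t))))
  (trans (cong (isLeftDescent (suc (suc m)) ((c , t) , suc p)) (toℕ-fromℕ (suc m)))
         (trans (isLeftDescent-last (suc m) (c , t) (suc p)) (≰⇒≤ᵇ≡false _ _ p≰t)))

leftMul : ∀ m (c : Code m) (i : Fin m) → LeftMul m c i
leftMul (suc m) (c , p) i with fromℕ-or-inject₁ i
... | inj₁ refl = leftMul-fromℕ m c p
... | inj₂ (i′ , refl) with leftMul m c i′
...   | ascent c′ h r  =
  ascent (c′ , p) (++-congʳ (insertionWord (suc m) p) (≈-map-inject₁ h)) (trans (isLeftDescent-inject₁ m c p i′) r)
...   | descent c′ h r =
  descent (c′ , p) (++-congʳ (insertionWord (suc m) p) (≈-map-inject₁ h)) (trans (isLeftDescent-inject₁ m c p i′) r)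

insertAt : {A : Set} → ℕ → A → List A → List A
insertAt zero    x L       = x ∷ L
insertAt (suc p) x []      = [ x ]
insertAt (suc p) x (y ∷ L) = y ∷ insertAt p x L

applyWord-insertionWord : ∀ m (p : Fin (suc m)) (L : List ℕ) x → length L ≡ m →
  applyWord (insertionWord m p) (L ++ [ x ]) ≡ insertAt (toℕ p) x L
applyWord-insertionWord zero    zero    []      x refl = refl
applyWord-insertionWord (suc m) zero    (y ∷ L) x h    =
  trans (applyWord-++ (map suc (insertionWord m zero)) [ zero ] (y ∷ L ++ [ x ]))
        (cong (swapAdjacent 0) (trans (applyWord-map-suc (insertionWord m zero) y (L ++ [ x ]))
                                      (cong (y ∷_) (applyWord-insertionWord m zero L x (suc-injective h)))))
applyWord-insertionWord (suc m) (suc p) (y ∷ L) x h    =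
  trans (applyWord-map-suc (insertionWord m p) y (L ++ [ x ])) (cong (y ∷_) (applyWord-insertionWord m p L x (suc-injective h)))

oneLine-codeWord : ∀ m (c : Code m) p →
  oneLine (codeWord (suc m) (c , p)) ≡ insertAt (toℕ p) (suc m) (oneLine (codeWord m c))
oneLine-codeWord m c p = begin
  oneLine (codeWord (suc m) (c , p))
    ≡⟨ applyWord-++ (map inject₁ (codeWord m c)) (insertionWord (suc m) p) (range 0 (suc (suc m))) ⟩
  applyWord (insertionWord (suc m) p) (applyWord (map inject₁ (codeWord m c)) (range 0 (suc (suc m))))
    ≡⟨ cong (λ z → applyWord (insertionWord (suc m) p) (applyWord (map inject₁ (codeWord m c)) z)) (range-snoc 0 (suc m)) ⟩
  applyWord (insertionWord (suc m) p) (applyWord (map inject₁ (codeWord m c)) (range 0 (suc m) ++ [ suc m ]))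
    ≡⟨ cong (applyWord (insertionWord (suc m) p)) (applyWord-map-inject₁ (codeWord m c) _) ⟩
  applyWord (insertionWord (suc m) p) (applyWord (codeWord m c) (range 0 (suc m) ++ [ suc m ]))
    ≡⟨ cong (applyWord (insertionWord (suc m) p))
            (applyWord-snoc (codeWord m c) (range 0 (suc m)) (suc m) (length-range 0 (suc m))) ⟩
  applyWord (insertionWord (suc m) p) (oneLine (codeWord m c) ++ [ suc m ])
    ≡⟨ applyWord-insertionWord (suc m) p (oneLine (codeWord m c)) (suc m) (length-oneLine (codeWord m c)) ⟩
  insertAt (toℕ p) (suc m) (oneLine (codeWord m c)) ∎
  where open ≡-Reasoning

All-swapAdjacent : {A : Set} {Q : A → Set} → ∀ i (L : List A) → All Q L → All Q (swapAdjacent i L)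
All-swapAdjacent zero    []          a                = a
All-swapAdjacent zero    (x ∷ [])    a                = a
All-swapAdjacent zero    (x ∷ y ∷ L) (qx ∷ qy ∷ a)    = qy ∷ qx ∷ a
All-swapAdjacent (suc i) []          a                = a
All-swapAdjacent (suc i) (x ∷ L)     (qx ∷ a)         = qx ∷ All-swapAdjacent i L a

All-applySwaps : {A : Set} {Q : A → Set} → ∀ w (L : List A) → All Q L → All Q (applySwaps w L)
All-applySwaps []      L a = a
All-applySwaps (i ∷ w) L a = All-applySwaps w (swapAdjacent i L) (All-swapAdjacent i L a)

range-< : ∀ a n → All (_< a + n) (range a n)
range-< a zero    = []
range-< a (suc n) = subst (a <_) (sym (+-suc a n)) (s≤s (m≤m+n a n))
                  ∷ subst (λ k → All (_< k) (range (suc a) n)) (sym (+-suc a n)) (range-< (suc a) n)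

oneLine-< : (w : Word m) → All (_< suc m) (oneLine w)
oneLine-< {m} w = All-applySwaps (map toℕ w) (range 0 (suc m)) (range-< 0 (suc m))

insertAt-injective : ∀ p p′ (x : ℕ) L L′ → All (_< x) L → All (_< x) L′ → p ≤ length L → p′ ≤ length L′ →
  insertAt p x L ≡ insertAt p′ x L′ → (p ≡ p′) × (L ≡ L′)
insertAt-injective zero    zero     x L       L′        _        _         _       _        e = refl , proj₂ (∷-injective e)
insertAt-injective zero    (suc p′) x L       (y ∷ L′)  _        (y<x ∷ _) _       _        e =
  ⊥-elim (<-irrefl (sym (proj₁ (∷-injective e))) y<x)
insertAt-injective (suc p) zero     x (y ∷ L) L′        (y<x ∷ _) _        _       _        e =
  ⊥-elim (<-irrefl (proj₁ (∷-injective e)) y<x)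
insertAt-injective (suc p) (suc p′) x (y ∷ L) (y′ ∷ L′) (_ ∷ a)  (_ ∷ a′)  (s≤s h) (s≤s h′) e
  with ∷-injective e
... | y≡y′ , rest with insertAt-injective p p′ x L L′ a a′ h h′ rest
... | p≡p′ , L≡L′ = cong suc p≡p′ , cong₂ _∷_ y≡y′ L≡L′

oneLine-codeWord-injective : ∀ m (c c′ : Code m) → oneLine (codeWord m c) ≡ oneLine (codeWord m c′) → c ≡ c′
oneLine-codeWord-injective zero    tt      tt        e = refl
oneLine-codeWord-injective (suc m) (c , p) (c′ , p′) e
  with insertAt-injective (toℕ p) (toℕ p′) (suc m) (oneLine (codeWord m c)) (oneLine (codeWord m c′))
         (oneLine-< (codeWord m c)) (oneLine-< (codeWord m c′))
         (subst (toℕ p ≤_) (sym (length-oneLine (codeWord m c))) (≤-pred (toℕ<n p)))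
         (subst (toℕ p′ ≤_) (sym (length-oneLine (codeWord m c′))) (≤-pred (toℕ<n p′)))
         (trans (sym (oneLine-codeWord m c p)) (trans e (oneLine-codeWord m c′ p′)))
... | p≡p′ , rest = cong₂ _,_ (oneLine-codeWord-injective m c c′ rest) (toℕ-injective p≡p′)

codeWord-injective : ∀ m (c c′ : Code m) → codeWord m c ≈ codeWord m c′ → c ≡ c′
codeWord-injective m c c′ h = oneLine-codeWord-injective m c c′ (oneLine-≈ h)

-- Simple braids are exactly the code words

longestCode : (m : ℕ) → Code m
longestCode zero    = tt
longestCode (suc m) = longestCode m , zero

identityCode : (m : ℕ) → Code m
identityCode zero    = tt
identityCode (suc m) = identityCode m , fromℕ (suc m)

length-codeWord : ∀ m (c : Code m) p → length (codeWord (suc m) (c , p)) ≡ length (codeWord m c) + (suc m ∸ toℕ p)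
length-codeWord m c p = trans (length-++ (map inject₁ (codeWord m c)))
  (cong₂ _+_ (length-map inject₁ (codeWord m c)) (length-insertionWord (suc m) p))

length-codeWord≤triangle : ∀ m (c : Code m) → length (codeWord m c) ≤ triangle m
length-codeWord≤triangle zero    tt      = z≤n
length-codeWord≤triangle (suc m) (c , p) = begin
  length (codeWord (suc m) (c , p))         ≡⟨ length-codeWord m c p ⟩
  length (codeWord m c) + (suc m ∸ toℕ p)   ≤⟨ +-mono-≤ (length-codeWord≤triangle m c) (m∸n≤m (suc m) (toℕ p)) ⟩
  triangle m + suc m                        ≡⟨ +-comm (triangle m) (suc m) ⟩
  triangle (suc m)                          ∎
  where open ≤-Reasoning

+-≤-split-≡ : ∀ {a b A B} → a ≤ A → b ≤ B → a + b ≡ A + B → (a ≡ A) × (b ≡ B)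
+-≤-split-≡ {a} {b} {A} {B} a≤A b≤B e = a≡A , b≡B
  where
  a≡A : a ≡ A
  a≡A = ≤-antisym a≤A (+-cancelʳ-≤ B A a (≤-trans (≤-reflexive (sym e)) (+-monoʳ-≤ a b≤B)))
  b≡B : b ≡ B
  b≡B = ≤-antisym b≤B (+-cancelˡ-≤ A B b (≤-reflexive (trans (sym e) (cong (_+ b) a≡A))))

1+m∸k≡1+m⇒k≡0 : ∀ m k → suc m ∸ k ≡ suc m → k ≡ 0
1+m∸k≡1+m⇒k≡0 m zero    e = refl
1+m∸k≡1+m⇒k≡0 m (suc k) e = ⊥-elim (<-irrefl e (s≤s (m∸n≤m m k)))

length-codeWord≡triangle⇒longest : ∀ m (c : Code m) → length (codeWord m c) ≡ triangle m → c ≡ longestCode m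
length-codeWord≡triangle⇒longest zero    tt      e = refl
length-codeWord≡triangle⇒longest (suc m) (c , p) e
  with +-≤-split-≡ (length-codeWord≤triangle m c) (m∸n≤m (suc m) (toℕ p))
         (trans (sym (length-codeWord m c p)) (trans e (+-comm (suc m) (triangle m))))
... | lc≡ , p≡ =
  cong₂ _,_ (length-codeWord≡triangle⇒longest m c lc≡) (toℕ-injective (1+m∸k≡1+m⇒k≡0 m (toℕ p) p≡))

insertionWord-fromℕ : ∀ m → insertionWord m (fromℕ m) ≡ []
insertionWord-fromℕ zero    = refl
insertionWord-fromℕ (suc m) = cong (map suc) (insertionWord-fromℕ m)

codeWord-identity : ∀ m → codeWord m (identityCode m) ≡ []
codeWord-identity zero    = refl
codeWord-identity (suc m) = cong₂ _++_ (cong (map inject₁) (codeWord-identity m)) (insertionWord-fromℕ (suc m))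

longest⊎rightAscent : ∀ m (c : Code m) →
  (c ≡ longestCode m) ⊎ Σ (Fin m) (λ i → isRightDescent m c (toℕ i) ≡ false)
longest⊎rightAscent zero    tt            = inj₁ refl
longest⊎rightAscent (suc m) (c , zero)    with longest⊎rightAscent m c
... | inj₁ e       = inj₁ (cong (_, zero) e)
... | inj₂ (i , r) = inj₂ (suc i , r)
longest⊎rightAscent (suc m) (c , suc i)   = inj₂ (i , insertedDescent-just-below (toℕ i) (isRightDescent m c))

Reduced : Word m → Set
Reduced w = inversions (oneLine w) ≡ length w

2+n≰n : ∀ n → ¬ (suc (suc n) ≤ n)
2+n≰n n h = 1+n≰n (≤-trans (n≤1+n (suc n)) h)

same-oneLine-shorter⇒¬Reduced : ∀ {v : Word m} (z : Word m) → oneLine v ≡ oneLine z → length v ≡ suc (suc (length z)) →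
  ¬ Reduced v
same-oneLine-shorter⇒¬Reduced {v = v} z same-perm len red = 2+n≰n (length z) (begin
  suc (suc (length z))   ≡⟨ len ⟨
  length v               ≡⟨ red ⟨
  inversions (oneLine v) ≡⟨ cong inversions same-perm ⟩
  inversions (oneLine z) ≤⟨ inversions-oneLine≤length z ⟩
  length z               ∎)
  where open ≤-Reasoning

length-snoc-snoc : ∀ (z : Word m) i → length ((z ++ [ i ]) ++ [ i ]) ≡ suc (suc (length z))
length-snoc-snoc z i = trans (length-++ (z ++ [ i ])) (trans (cong (_+ 1) (length-++ z))
  (trans (cong (_+ 1) (+-comm (length z) 1)) (+-comm (suc (length z)) 1)))

square-not-reducedʳ : ∀ {v : Word m} (z : Word m) i → v ≈ ((z ++ [ i ]) ++ [ i ]) → ¬ Reduced v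
square-not-reducedʳ {v = v} z i h = same-oneLine-shorter⇒¬Reduced {v = v} z
  (trans (oneLine-≈ h) (trans (oneLine-snoc (z ++ [ i ]) i)
    (trans (cong (swapAdjacent (toℕ i)) (oneLine-snoc z i)) (swapAdjacent-involutive (toℕ i) (oneLine z)))))
  (trans (length-≈ h) (length-snoc-snoc z i))

square-not-reducedˡ : ∀ {v : Word m} (z : Word m) i → v ≈ (i ∷ i ∷ z) → ¬ Reduced v
square-not-reducedˡ {m} {v} z i h = same-oneLine-shorter⇒¬Reduced {v = v} z
  (trans (oneLine-≈ h) (cong (applyWord z) (swapAdjacent-involutive (toℕ i) (range 0 (suc m)))))
  (length-≈ h)

Reduced-init : (w : Word m) (i : Fin m) → Reduced (w ++ [ i ]) → Reduced w
Reduced-init w i red = ≤-antisym (inversions-oneLine≤length w) (≤-pred (begin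
  suc (length w)                                      ≡⟨ +-comm 1 (length w) ⟩
  length w + 1                                        ≡⟨ length-++ w ⟨
  length (w ++ [ i ])                                 ≡⟨ red ⟨
  inversions (oneLine (w ++ [ i ]))                   ≡⟨ cong inversions (oneLine-snoc w i) ⟩
  inversions (swapAdjacent (toℕ i) (oneLine w))       ≤⟨ inversions-swapAdjacent (toℕ i) (oneLine w) ⟩
  suc (inversions (oneLine w))                        ∎))
  where open ≤-Reasoning

-- Induction on the last letter: the reduced prefix is a code word, and multiplying by the last letter
-- must be an ascent since a descent would make the word non-reduced.
reduced⇒codeWord : (w : Word m) → Reduced w → Σ (Code m) (λ c → w ≈ codeWord m c)
reduced⇒codeWord w red with reduced-reverse (reverse w) (subst Reduced (sym (reverse-involutive w)) red)
  where
  reduced-reverse : ∀ {m} (u : Word m) → Reduced (reverse u) → Σ (Code m) (λ c → reverse u ≈ codeWord m c)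
  reduced-reverse {m} []      _   = identityCode m , ≡⇒≈ (sym (codeWord-identity m))
  reduced-reverse {m} (i ∷ u) red with reduced-reverse u (Reduced-init (reverse u) i red′)
    where
    red′ : Reduced (reverse u ++ [ i ])
    red′ = subst Reduced (unfold-reverse i u) red
  ... | c , hc with rightMul m c i
  ...   | ascent c′ h _ = c′ , ≈-trans (≡⇒≈ (unfold-reverse i u)) (≈-trans (++-congʳ [ i ] hc) h)
  ...   | descent c′ h _ = ⊥-elim (square-not-reducedʳ (codeWord m c′) i
                              (≈-trans (≡⇒≈ (unfold-reverse i u)) (≈-trans (++-congʳ [ i ] hc) (++-congʳ [ i ] h))) red)
... | c , h = c , ≈-trans (≡⇒≈ (sym (reverse-involutive w))) h

Δ-reduced : ∀ m → Reduced (Δ m)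
Δ-reduced m = trans (inversions-oneLine-Δ m) (sym (length-Δ m))

Δ≈longest : ∀ m → Δ m ≈ codeWord m (longestCode m)
Δ≈longest m with reduced⇒codeWord (Δ m) (Δ-reduced m)
... | c , h = subst (λ z → Δ m ≈ codeWord m z)
                    (length-codeWord≡triangle⇒longest m c (trans (sym (length-≈ h)) (length-Δ m))) h

-- Right ascents keep lengthening the word until the longest code is reached.
codeWord-≼-longest : ∀ m k (c : Code m) → triangle m ∸ length (codeWord m c) ≡ k →
  Σ (Word m) (λ z → (codeWord m c ++ z) ≈ codeWord m (longestCode m))
codeWord-≼-longest m zero c e =
  [] , ≡⇒≈ (trans (++-identityʳ (codeWord m c)) (cong (codeWord m)
          (length-codeWord≡triangle⇒longest m c (≤-antisym (length-codeWord≤triangle m c) (m∸n≡0⇒m≤n e)))))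
codeWord-≼-longest m (suc k) c e with longest⊎rightAscent m c
... | inj₁ c≡longest = [] , ≡⇒≈ (trans (++-identityʳ (codeWord m c)) (cong (codeWord m) c≡longest))
... | inj₂ (i , asc) with rightMul m c i
...   | descent _ _ desc = ⊥-elim (true≢false (trans (sym desc) asc))
...   | ascent c′ h _ with codeWord-≼-longest m k c′ e′
  where
  length-c′ : length (codeWord m c′) ≡ suc (length (codeWord m c))
  length-c′ = trans (sym (length-≈ h)) (trans (length-++ (codeWord m c)) (+-comm (length (codeWord m c)) 1))
  e′ : triangle m ∸ length (codeWord m c′) ≡ k
  e′ = trans (cong (triangle m ∸_) length-c′)
             (trans (sym (pred[m∸n]≡m∸[1+n] (triangle m) (length (codeWord m c)))) (cong pred e))
...     | z , hz = (i ∷ z) , ≈-trans (≡⇒≈ (sym (++-assoc (codeWord m c) [ i ] z))) (≈-trans (++-congʳ z h) hz)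

codeWord-simple : ∀ m (c : Code m) → IsSimple m (codeWord m c)
codeWord-simple m c with codeWord-≼-longest m _ c refl
... | z , h = z , ≈-trans h (≈-sym (Δ≈longest m))

prefix-of-Δ-reduced : (x z : Word m) → (x ++ z) ≈ Δ m → Reduced x
prefix-of-Δ-reduced {m} x z h =
  ≤-antisym (inversions-oneLine≤length x) (+-cancelʳ-≤ (length z) (length x) (inversions (oneLine x)) (begin
    length x + length z                         ≡⟨ length-++ x ⟨
    length (x ++ z)                             ≡⟨ length-≈ h ⟩
    length (Δ m)                                ≡⟨ Δ-reduced m ⟨
    inversions (oneLine (Δ m))                  ≡⟨ cong inversions (oneLine-≈ h) ⟨
    inversions (oneLine (x ++ z))               ≡⟨ cong inversions (applyWord-++ x z (range 0 (suc m))) ⟩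
    inversions (applyWord z (oneLine x))        ≤⟨ inversions-applyWord z (oneLine x) ⟩
    inversions (oneLine x) + length z           ∎))
  where open ≤-Reasoning

simple⇒codeWord : ∀ m (x : Word m) → IsSimple m x → Σ (Code m) (λ c → x ≈ codeWord m c)
simple⇒codeWord m x (z , h) = reduced⇒codeWord x (prefix-of-Δ-reduced x z h)

codeWord-reduced : ∀ m (c : Code m) → Reduced (codeWord m c)
codeWord-reduced m c with codeWord-simple m c
... | z , h = prefix-of-Δ-reduced (codeWord m c) z h

InDR⇒isRightDescent : ∀ m (c : Code m) (j : Fin m) → InDR j (codeWord m c) → isRightDescent m c (toℕ j) ≡ true
InDR⇒isRightDescent m c j (z , h) with rightMul m c j
... | descent _ _ r = r
... | ascent c′ h′ _ = ⊥-elim (square-not-reducedʳ z j (≈-sym (≈-trans (++-congʳ [ j ] h) h′)) (codeWord-reduced m c′))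

isRightDescent⇒InDR : ∀ m (c : Code m) (j : Fin m) → isRightDescent m c (toℕ j) ≡ true → InDR j (codeWord m c)
isRightDescent⇒InDR m c j r with rightMul m c j
... | descent c′ h _  = codeWord m c′ , ≈-sym h
... | ascent _ _ r′   = ⊥-elim (true≢false (trans (sym r) r′))

InDL⇒isLeftDescent : ∀ m (c : Code m) (i : Fin m) → InDL i (codeWord m c) → isLeftDescent m c (toℕ i) ≡ true
InDL⇒isLeftDescent m c i (z , h) with leftMul m c i
... | descent _ _ r = r
... | ascent c′ h′ _ = ⊥-elim (square-not-reducedˡ z i (≈-sym (≈-trans (++-congˡ [ i ] h) h′)) (codeWord-reduced m c′))

isLeftDescent⇒InDL : ∀ m (c : Code m) (i : Fin m) → isLeftDescent m c (toℕ i) ≡ true → InDL i (codeWord m c)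
isLeftDescent⇒InDL m c i r with leftMul m c i
... | descent c′ h _ = codeWord m c′ , ≈-sym h
... | ascent _ _ r′  = ⊥-elim (true≢false (trans (sym r) r′))

≡ᵇ≡true⇒≡ : ∀ a b → (a ≡ᵇ b) ≡ true → a ≡ b
≡ᵇ≡true⇒≡ a b e = ≡ᵇ⇒≡ a b (subst T (sym e) tt)

≡ᵇ≡false⇒≢ : ∀ a b → (a ≡ᵇ b) ≡ false → a ≢ b
≡ᵇ≡false⇒≢ zero    zero    () e
≡ᵇ≡false⇒≢ (suc a) (suc b) h  e = ≡ᵇ≡false⇒≢ a b h (suc-injective e)

≢⇒≡ᵇ≡false : ∀ a b → a ≢ b → (a ≡ᵇ b) ≡ false
≢⇒≡ᵇ≡false zero    zero    h = ⊥-elim (h refl)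
≢⇒≡ᵇ≡false zero    (suc b) h = refl
≢⇒≡ᵇ≡false (suc a) zero    h = refl
≢⇒≡ᵇ≡false (suc a) (suc b) h = ≢⇒≡ᵇ≡false a b (h ∘ cong suc)

≤ᵇ≡true⇒≤ : ∀ a b → (a ≤ᵇ b) ≡ true → a ≤ b
≤ᵇ≡true⇒≤ a b e = ≤ᵇ⇒≤ a b (subst T (sym e) tt)

bit-≡ᵇ-refl : ∀ x → bit (x ≡ᵇ x) ≡ 1
bit-≡ᵇ-refl x rewrite ≡ᵇ-refl x = refl

-- The j-th entry, 0 beyond the end.
entry : List ℕ → ℕ → ℕ
entry []      j       = 0
entry (x ∷ L) zero    = x
entry (x ∷ L) (suc j) = entry L j

count : ℕ → List ℕ → ℕ
count a []      = 0
count a (x ∷ L) = bit (x ≡ᵇ a) + count a L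

-- The position of the first occurrence of x, or length L if there is none.
firstIndex : ℕ → List ℕ → ℕ
firstIndex x []      = 0
firstIndex x (y ∷ L) = if y ≡ᵇ x then 0 else suc (firstIndex x L)

deleteFirst : ℕ → List ℕ → List ℕ
deleteFirst x []      = []
deleteFirst x (y ∷ L) = if y ≡ᵇ x then L else y ∷ deleteFirst x L

length-insertAt : ∀ p (x : ℕ) L → length (insertAt p x L) ≡ suc (length L)
length-insertAt zero    x L       = refl
length-insertAt (suc p) x []      = refl
length-insertAt (suc p) x (y ∷ L) = cong suc (length-insertAt p x L)

count-insertAt : ∀ a p x L → count a (insertAt p x L) ≡ bit (x ≡ᵇ a) + count a L
count-insertAt a zero    x L       = refl
count-insertAt a (suc p) x []      = refl
count-insertAt a (suc p) x (y ∷ L) =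
  trans (cong (bit (y ≡ᵇ a) +_) (count-insertAt a p x L)) (x∙yz≈y∙xz (bit (y ≡ᵇ a)) (bit (x ≡ᵇ a)) (count a L))

All-insertAt : {Q : ℕ → Set} → ∀ p x L → Q x → All Q L → All Q (insertAt p x L)
All-insertAt zero    x L       q a        = q ∷ a
All-insertAt (suc p) x []      q a        = q ∷ []
All-insertAt (suc p) x (y ∷ L) q (qy ∷ a) = qy ∷ All-insertAt p x L q a

entry-insertAt-< : ∀ p x L j → j < p → p ≤ length L → entry (insertAt p x L) j ≡ entry L j
entry-insertAt-< (suc p) x (y ∷ L) zero    h       h′       = refl
entry-insertAt-< (suc p) x (y ∷ L) (suc j) (s≤s h) (s≤s h′) = entry-insertAt-< p x L j h h′

entry-insertAt-≡ : ∀ p x L → p ≤ length L → entry (insertAt p x L) p ≡ x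
entry-insertAt-≡ zero    x L       h       = refl
entry-insertAt-≡ (suc p) x (y ∷ L) (s≤s h) = entry-insertAt-≡ p x L h

entry-insertAt-> : ∀ p x L j → p ≤ j → entry (insertAt p x L) (suc j) ≡ entry L j
entry-insertAt-> zero    x L       j       h       = refl
entry-insertAt-> (suc p) x []      (suc j) h       = refl
entry-insertAt-> (suc p) x (y ∷ L) (suc j) (s≤s h) = entry-insertAt-> p x L j h

firstIndex-insertAt : ∀ p x L → p ≤ firstIndex x L → firstIndex x (insertAt p x L) ≡ p
firstIndex-insertAt zero    x L       h rewrite ≡ᵇ-refl x = refl
firstIndex-insertAt (suc p) x (y ∷ L) h with y ≡ᵇ x
... | true  = ⊥-elim (n≮0 h)
... | false = cong suc (firstIndex-insertAt p x L (≤-pred h))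

deleteFirst-insertAt : ∀ p x L → p ≤ firstIndex x L → deleteFirst x (insertAt p x L) ≡ L
deleteFirst-insertAt zero    x L       h rewrite ≡ᵇ-refl x = refl
deleteFirst-insertAt (suc p) x (y ∷ L) h with y ≡ᵇ x
... | true  = ⊥-elim (n≮0 h)
... | false = cong (y ∷_) (deleteFirst-insertAt p x L (≤-pred h))

insertAt-deleteFirst : ∀ x L → 1 ≤ count x L → insertAt (firstIndex x L) x (deleteFirst x L) ≡ L
insertAt-deleteFirst x (y ∷ L) h with y ≡ᵇ x in eq
... | true  = cong (_∷ L) (sym (≡ᵇ≡true⇒≡ y x eq))
... | false = cong (y ∷_) (insertAt-deleteFirst x L h)

firstIndex-deleteFirst : ∀ x L → firstIndex x L ≤ firstIndex x (deleteFirst x L)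
firstIndex-deleteFirst x []      = z≤n
firstIndex-deleteFirst x (y ∷ L) with y ≡ᵇ x in eq
... | true  = z≤n
... | false rewrite eq = s≤s (firstIndex-deleteFirst x L)

firstIndex<length : ∀ x L → 1 ≤ count x L → firstIndex x L < length L
firstIndex<length x (y ∷ L) h with y ≡ᵇ x
... | true  = s≤s z≤n
... | false = s≤s (firstIndex<length x L h)

entry-firstIndex : ∀ x L → 1 ≤ count x L → entry L (firstIndex x L) ≡ x
entry-firstIndex x (y ∷ L) h with y ≡ᵇ x in eq
... | true  = ≡ᵇ≡true⇒≡ y x eq
... | false = entry-firstIndex x L h

entry-before-firstIndex : ∀ x L j → j < firstIndex x L → entry L j ≢ x
entry-before-firstIndex x (y ∷ L) zero    h with y ≡ᵇ x in eq
... | true  = ⊥-elim (n≮0 h)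
... | false = ≡ᵇ≡false⇒≢ y x eq
entry-before-firstIndex x (y ∷ L) (suc j) h with y ≡ᵇ x
... | true  = ⊥-elim (n≮0 h)
... | false = entry-before-firstIndex x L j (≤-pred h)

count-deleteFirst : ∀ a x L → 1 ≤ count x L → bit (x ≡ᵇ a) + count a (deleteFirst x L) ≡ count a L
count-deleteFirst a x L h =
  trans (sym (count-insertAt a (firstIndex x L) x (deleteFirst x L))) (cong (count a) (insertAt-deleteFirst x L h))

length-deleteFirst : ∀ x L → 1 ≤ count x L → suc (length (deleteFirst x L)) ≡ length L
length-deleteFirst x L h =
  trans (sym (length-insertAt (firstIndex x L) x (deleteFirst x L))) (cong length (insertAt-deleteFirst x L h))

firstIndex≤length-deleteFirst : ∀ x L → 1 ≤ count x L → firstIndex x L ≤ length (deleteFirst x L)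
firstIndex≤length-deleteFirst x L h =
  ≤-pred (subst (suc (firstIndex x L) ≤_) (sym (length-deleteFirst x L h)) (firstIndex<length x L h))

entry-deleteFirst-< : ∀ x L j → 1 ≤ count x L → j < firstIndex x L → entry (deleteFirst x L) j ≡ entry L j
entry-deleteFirst-< x L j h j<f = trans
  (sym (entry-insertAt-< (firstIndex x L) x (deleteFirst x L) j j<f (firstIndex≤length-deleteFirst x L h)))
  (cong (λ z → entry z j) (insertAt-deleteFirst x L h))

entry-deleteFirst-≥ : ∀ x L j → 1 ≤ count x L → firstIndex x L ≤ j → entry (deleteFirst x L) j ≡ entry L (suc j)
entry-deleteFirst-≥ x L j h f≤j = trans
  (sym (entry-insertAt-> (firstIndex x L) x (deleteFirst x L) j f≤j))
  (cong (λ z → entry z (suc j)) (insertAt-deleteFirst x L h))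

firstIndex-absent : ∀ x L B → All (_≤ B) L → B < x → firstIndex x L ≡ length L
firstIndex-absent x []      B a       h = refl
firstIndex-absent x (y ∷ L) B (q ∷ a) h rewrite ≢⇒≡ᵇ≡false y x (λ y≡x → <-irrefl y≡x (≤-<-trans q h)) =
  cong suc (firstIndex-absent x L B a h)

entry-≤ : ∀ L B j → All (_≤ B) L → entry L j ≤ B
entry-≤ []      B j       a       = z≤n
entry-≤ (x ∷ L) B zero    (q ∷ a) = q
entry-≤ (x ∷ L) B (suc j) (q ∷ a) = entry-≤ L B j a

count-pos⇒≤ : ∀ y L B → All (_≤ B) L → 1 ≤ count y L → y ≤ B
count-pos⇒≤ y (x ∷ L) B (q ∷ a) h with x ≡ᵇ y in eq
... | true  = subst (_≤ B) (≡ᵇ≡true⇒≡ x y eq) q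
... | false = count-pos⇒≤ y L B a h

All-≤-from-count : ∀ L B → (∀ y → 1 ≤ count y L → y ≤ B) → All (_≤ B) L
All-≤-from-count []      B f = []
All-≤-from-count (x ∷ L) B f = f x (subst (λ z → 1 ≤ z + count x L) (sym (bit-≡ᵇ-refl x)) (s≤s z≤n))
                             ∷ All-≤-from-count L B (λ y h → f y (≤-trans h (m≤n+m _ _)))

All-≤-of-same-counts : ∀ L L₀ B → (∀ a → count a L ≡ count a L₀) → All (_≤ B) L₀ → All (_≤ B) L
All-≤-of-same-counts L L₀ B e a = All-≤-from-count L B (λ y h → count-pos⇒≤ y L₀ B a (subst (1 ≤_) (e y) h))

count-∷-≡ : ∀ x β → count x (x ∷ β) ≡ suc (count x β)
count-∷-≡ x β = cong (_+ count x β) (bit-≡ᵇ-refl x)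

count-∷-≢ : ∀ x a β → x ≢ a → count a (x ∷ β) ≡ count a β
count-∷-≢ x a β x≢a = cong (λ z → bit z + count a β) (≢⇒≡ᵇ≡false x a x≢a)

count-snoc : ∀ a L x → count a (L ++ [ x ]) ≡ count a L + bit (x ≡ᵇ a)
count-snoc a []      x = +-identityʳ _
count-snoc a (y ∷ L) x =
  trans (cong (bit (y ≡ᵇ a) +_) (count-snoc a L x)) (sym (+-assoc (bit (y ≡ᵇ a)) (count a L) _))

-- From codes to arrangements of the blocks

-- The block of the composition [I]ₙ containing the value v ∈ {0, …, m}: v and v+1 share a block iff I v.
block : (ℕ → Bool) → ℕ → ℕ
block I zero    = 0
block I (suc v) = block I v + (if I v then 0 else 1)

block-suc-≥ : ∀ I v → block I v ≤ block I (suc v)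
block-suc-≥ I v = m≤m+n (block I v) _

block-mono : ∀ I v w → v ≤ w → block I v ≤ block I w
block-mono I v zero    z≤n = ≤-refl
block-mono I v (suc w) h   with m≤n⇒m<n∨m≡n h
... | inj₁ v<1+w = ≤-trans (block-mono I v w (≤-pred v<1+w)) (block-suc-≥ I w)
... | inj₂ refl  = ≤-refl

block-member : ∀ I m → I m ≡ true → block I (suc m) ≡ block I m
block-member I m e rewrite e = +-identityʳ _

blockList : (ℕ → Bool) → ℕ → List ℕ
blockList I m = map (block I) (range 0 (suc m))

blockList-≤ : ∀ I m → All (_≤ block I m) (blockList I m)
blockList-≤ I m = map⁺ (All.map (λ h → block-mono I _ m (≤-pred h)) (range-< 0 (suc m)))

count-blockList-snoc : ∀ a I m → count a (blockList I (suc m)) ≡ count a (blockList I m) + bit (block I (suc m) ≡ᵇ a)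
count-blockList-snoc a I m = begin
  count a (map (block I) (range 0 (suc (suc m))))
    ≡⟨ cong (λ z → count a (map (block I) z)) (range-snoc 0 (suc m)) ⟩
  count a (map (block I) (range 0 (suc m) ++ [ suc m ]))
    ≡⟨ cong (count a) (map-++ (block I) (range 0 (suc m)) [ suc m ]) ⟩
  count a (blockList I m ++ [ block I (suc m) ])
    ≡⟨ count-snoc a (blockList I m) _ ⟩
  count a (blockList I m) + bit (block I (suc m) ≡ᵇ a) ∎
  where open ≡-Reasoning

WeaklyDescendsOn : (ℕ → Bool) → List ℕ → Set
WeaklyDescendsOn J β = ∀ j → J j ≡ true → entry β (suc j) ≤ entry β j

record Arrangement (m : ℕ) (I J : ℕ → Bool) (β : List ℕ) : Set where
  constructor arrangement
  field
    length≡  : length β ≡ suc m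
    counts≡  : ∀ a → count a β ≡ count a (blockList I m)
    descends : WeaklyDescendsOn J β

record DescentsContain (m : ℕ) (I J : ℕ → Bool) (c : Code m) : Set where
  constructor descents
  field
    left  : ∀ i → i < m → I i ≡ true → isLeftDescent m c i ≡ true
    right : ∀ j → j < m → J j ≡ true → isRightDescent m c j ≡ true

-- The gaps of a list after deleting its entry at position p, as gaps of the original list.
dropGap : (ℕ → Bool) → ℕ → ℕ → Bool
dropGap J p j = if j <ᵇ p then J j else J (suc j)

dropGap-< : ∀ J p j → j < p → dropGap J p j ≡ J j
dropGap-< J p j j<p rewrite <⇒<ᵇ≡true j p j<p = refl

dropGap-≥ : ∀ J p j → p ≤ j → dropGap J p j ≡ J (suc j)
dropGap-≥ J p j p≤j rewrite ≥⇒<ᵇ≡false j p p≤j = refl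

-- The one-line notation of codeWord m c with every value v replaced by block I v.  When I ⊆ D_L, the values
-- of a block occur in decreasing order, so firstIndex and deleteFirst recover the code from this image.
blockImage : (m : ℕ) → (ℕ → Bool) → Code m → List ℕ
blockImage zero    I tt      = [ 0 ]
blockImage (suc m) I (c , p) = insertAt (toℕ p) (block I (suc m)) (blockImage m I c)

length-blockImage : ∀ m I c → length (blockImage m I c) ≡ suc m
length-blockImage zero    I tt      = refl
length-blockImage (suc m) I (c , p) = trans (length-insertAt (toℕ p) _ (blockImage m I c)) (cong suc (length-blockImage m I c))

blockImage-≤ : ∀ m I c → All (_≤ block I m) (blockImage m I c)
blockImage-≤ zero    I tt      = z≤n ∷ []
blockImage-≤ (suc m) I (c , p) = All-insertAt (toℕ p) _ (blockImage m I c) ≤-refl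
  (All.map (λ h → ≤-trans h (block-suc-≥ I m)) (blockImage-≤ m I c))

record ValidInsertion (m : ℕ) (I J : ℕ → Bool) (c : Code m) (p : ℕ) : Set where
  constructor valid-insertion
  field
    rest          : DescentsContain m I (dropGap J p) c
    left-of-max   : I m ≡ true → p ≤ positionOfMax m c
    no-gap-before : ∀ q → suc q ≡ p → J q ≡ false

DescentsContain⇒ValidInsertion : ∀ m I J c (p : Fin (suc (suc m))) → DescentsContain (suc m) I J (c , p) →
  ValidInsertion m I J c (toℕ p)
DescentsContain⇒ValidInsertion m I J c p (descents left right) =
  valid-insertion (descents left′ right′) left-of-max no-gap-before
  where
  f = isRightDescent m c
  no-gap-before : ∀ q → suc q ≡ toℕ p → J q ≡ false
  no-gap-before q e with J q in eq
  ... | false = refl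
  ... | true  = ⊥-elim (true≢false (trans (sym (right q q<1+m eq))
                                           (subst (λ z → insertedDescent q z f ≡ false) e (insertedDescent-just-below q f))))
    where
    q<1+m : q < suc m
    q<1+m = subst (_≤ suc m) (sym e) (≤-pred (toℕ<n p))
  left′ : ∀ i → i < m → I i ≡ true → isLeftDescent m c i ≡ true
  left′ i i<m e = trans (sym (isLeftDescent-< m c p i i<m)) (left i (m<n⇒m<1+n i<m) e)
  left-of-max : I m ≡ true → toℕ p ≤ positionOfMax m c
  left-of-max e = ≤ᵇ≡true⇒≤ _ _ (trans (sym (isLeftDescent-last m c p)) (left m ≤-refl e))
  right′ : ∀ j → j < m → dropGap J (toℕ p) j ≡ true → f j ≡ true
  right′ j j<m e with j <? toℕ p
  ... | no j≮p = trans (sym (insertedDescent-above (toℕ p) j f (≮⇒≥ j≮p)))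
                       (right (suc j) (s≤s j<m) (trans (sym (dropGap-≥ J (toℕ p) j (≮⇒≥ j≮p))) e))
  ... | yes j<p with m≤n⇒m<n∨m≡n j<p
  ...   | inj₁ j+1<p = trans (sym (insertedDescent-below j (toℕ p) f (subst (_≤ toℕ p) (+-comm 2 j) j+1<p)))
                             (right j (m<n⇒m<1+n j<m) (trans (sym (dropGap-< J (toℕ p) j j<p)) e))
  ...   | inj₂ j+1≡p =
    ⊥-elim (true≢false (trans (sym (trans (sym (dropGap-< J (toℕ p) j j<p)) e)) (no-gap-before j j+1≡p)))

ValidInsertion⇒DescentsContain : ∀ m I J c (p : Fin (suc (suc m))) → ValidInsertion m I J c (toℕ p) →
  DescentsContain (suc m) I J (c , p)
ValidInsertion⇒DescentsContain m I J c p (valid-insertion (descents left right) left-of-max no-gap-before) =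
  descents left′ right′
  where
  f = isRightDescent m c
  left′ : ∀ i → i < suc m → I i ≡ true → isLeftDescent (suc m) (c , p) i ≡ true
  left′ i i<1+m e with m≤n⇒m<n∨m≡n (≤-pred i<1+m)
  ... | inj₁ i<m  = trans (isLeftDescent-< m c p i i<m) (left i i<m e)
  ... | inj₂ refl = trans (isLeftDescent-last m c p) (≤⇒≤ᵇ≡true _ _ (left-of-max e))
  right′ : ∀ j → j < suc m → J j ≡ true → insertedDescent j (toℕ p) f ≡ true
  right′ j j<1+m e with <-cmp j (toℕ p)
  ... | tri≈ _ refl _ = insertedDescent-at j f
  ... | tri< j<p _ _ with m≤n⇒m<n∨m≡n j<p
  ...   | inj₂ j+1≡p = ⊥-elim (true≢false (trans (sym e) (no-gap-before j j+1≡p)))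
  ...   | inj₁ j+1<p = trans (insertedDescent-below j (toℕ p) f (subst (_≤ toℕ p) (+-comm 2 j) j+1<p))
                             (right j (≤-pred (≤-trans j+1<p (≤-pred (toℕ<n p)))) (trans (dropGap-< J (toℕ p) j j<p) e))
  right′ (suc j) j<1+m e | tri> _ _ p<1+j = trans (insertedDescent-above (toℕ p) j f (≤-pred p<1+j))
                             (right j (≤-pred j<1+m) (trans (dropGap-≥ J (toℕ p) j (≤-pred p<1+j)) e))

≤-cast : ∀ {a b c d : ℕ} → a ≡ c → b ≡ d → c ≤ d → a ≤ b
≤-cast refl refl c≤d = c≤d

Arrangement-insertAt : ∀ m I J β p → p ≤ suc m → Arrangement m I (dropGap J p) β →
  (∀ q → suc q ≡ p → J q ≡ false) →
  Arrangement (suc m) I J (insertAt p (block I (suc m)) β)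
Arrangement-insertAt m I J β p p≤1+m (arrangement len counts desc) no-gap-before =
  arrangement (trans (length-insertAt p _ β) (cong suc len)) counts′ desc′
  where
  top = block I (suc m)
  p≤len : p ≤ length β
  p≤len = subst (p ≤_) (sym len) p≤1+m
  β≤top : All (_≤ top) β
  β≤top = All.map (λ h → ≤-trans h (block-suc-≥ I m))
                  (All-≤-of-same-counts β (blockList I m) (block I m) counts (blockList-≤ I m))
  counts′ : ∀ a → count a (insertAt p top β) ≡ count a (blockList I (suc m))
  counts′ a = begin
    count a (insertAt p top β)                    ≡⟨ count-insertAt a p top β ⟩
    bit (top ≡ᵇ a) + count a β                    ≡⟨ cong (bit (top ≡ᵇ a) +_) (counts a) ⟩
    bit (top ≡ᵇ a) + count a (blockList I m)      ≡⟨ +-comm (bit (top ≡ᵇ a)) _ ⟩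
    count a (blockList I m) + bit (top ≡ᵇ a)      ≡⟨ count-blockList-snoc a I m ⟨
    count a (blockList I (suc m))                 ∎
    where open ≡-Reasoning
  desc′ : WeaklyDescendsOn J (insertAt p top β)
  desc′ j e with <-cmp (suc j) p
  ... | tri< j+1<p _ _ =
    ≤-cast (entry-insertAt-< p top β (suc j) j+1<p p≤len) (entry-insertAt-< p top β j (<⇒≤ j+1<p) p≤len)
                                (desc j (trans (dropGap-< J p j (<⇒≤ j+1<p)) e))
  ... | tri≈ _ j+1≡p _ = ⊥-elim (true≢false (trans (sym e) (no-gap-before j j+1≡p)))
  ... | tri> _ _ p<j+1 with m≤n⇒m<n∨m≡n (≤-pred p<j+1)
  ...   | inj₂ refl =
    ≤-cast (entry-insertAt-> p top β p ≤-refl) (entry-insertAt-≡ p top β p≤len) (entry-≤ β top p β≤top)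
  desc′ (suc j) e | tri> _ _ p<j+2 | inj₁ p<j+1 =
    ≤-cast (entry-insertAt-> p top β (suc j) (<⇒≤ p<j+1)) (entry-insertAt-> p top β j (≤-pred p<j+1))
           (desc j (trans (dropGap-≥ J p j (≤-pred p<j+1)) e))

count-top-block-pos : ∀ m I β → (∀ a → count a β ≡ count a (blockList I (suc m))) → 1 ≤ count (block I (suc m)) β
count-top-block-pos m I β counts = subst (1 ≤_) (sym (trans (counts top) (count-blockList-snoc top I m)))
  (subst (λ z → 1 ≤ count top (blockList I m) + z) (sym (bit-≡ᵇ-refl top)) (m≤n+m 1 _))
  where top = block I (suc m)

Arrangement-deleteFirst : ∀ m I J β → Arrangement (suc m) I J β →
  let f = firstIndex (block I (suc m)) β in
  Arrangement m I (dropGap J f) (deleteFirst (block I (suc m)) β) × (∀ q → suc q ≡ f → J q ≡ false) × f < suc (suc m)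
Arrangement-deleteFirst m I J β (arrangement len counts desc) =
  arrangement len′ counts′ desc′ , no-gap-before , subst (firstIndex top β <_) len (firstIndex<length top β top∈β)
  where
  top = block I (suc m)
  f = firstIndex top β
  top∈β : 1 ≤ count top β
  top∈β = count-top-block-pos m I β counts
  β≤top : All (_≤ top) β
  β≤top = All-≤-of-same-counts β (blockList I (suc m)) top counts (blockList-≤ I (suc m))
  no-gap-before : ∀ q → suc q ≡ f → J q ≡ false
  no-gap-before q e with J q in eq
  ... | false = refl
  ... | true  = ⊥-elim (entry-before-firstIndex top β q (subst (q <_) e ≤-refl)
                  (≤-antisym (entry-≤ β top q β≤top)
                             (subst (_≤ entry β q) (trans (cong (entry β) e) (entry-firstIndex top β top∈β)) (desc q eq))))
  len′ : length (deleteFirst top β) ≡ suc m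
  len′ = suc-injective (trans (length-deleteFirst top β top∈β) len)
  counts′ : ∀ a → count a (deleteFirst top β) ≡ count a (blockList I m)
  counts′ a = +-cancelˡ-≡ (bit (top ≡ᵇ a)) _ _ (begin
    bit (top ≡ᵇ a) + count a (deleteFirst top β)  ≡⟨ count-deleteFirst a top β top∈β ⟩
    count a β                                     ≡⟨ counts a ⟩
    count a (blockList I (suc m))                 ≡⟨ count-blockList-snoc a I m ⟩
    count a (blockList I m) + bit (top ≡ᵇ a)      ≡⟨ +-comm _ (bit (top ≡ᵇ a)) ⟩
    bit (top ≡ᵇ a) + count a (blockList I m)      ∎)
    where open ≡-Reasoning
  desc′ : WeaklyDescendsOn (dropGap J f) (deleteFirst top β)
  desc′ j e with j <? f
  ... | no j≮f =
    ≤-cast (entry-deleteFirst-≥ top β (suc j) top∈β (m≤n⇒m≤1+n (≮⇒≥ j≮f))) (entry-deleteFirst-≥ top β j top∈β (≮⇒≥ j≮f))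
                        (desc (suc j) (trans (sym (dropGap-≥ J f j (≮⇒≥ j≮f))) e))
  ... | yes j<f with m≤n⇒m<n∨m≡n j<f
  ...   | inj₁ j+1<f = ≤-cast (entry-deleteFirst-< top β (suc j) top∈β j+1<f) (entry-deleteFirst-< top β j top∈β j<f)
                              (desc j (trans (sym (dropGap-< J f j j<f)) e))
  ...   | inj₂ j+1≡f = ⊥-elim (true≢false (trans (sym (trans (sym (dropGap-< J f j j<f)) e)) (no-gap-before j j+1≡f)))

mutual
  firstIndex-blockImage : ∀ m I J c → DescentsContain m I J c →
    firstIndex (block I m) (blockImage m I c) ≡ positionOfMax m c
  firstIndex-blockImage zero    I J tt      v = refl
  firstIndex-blockImage (suc m) I J (c , p) v =
    firstIndex-insertAt (toℕ p) (block I (suc m)) (blockImage m I c) (position≤firstIndex m I J c p v)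

  position≤firstIndex : ∀ m I J c (p : Fin (suc (suc m))) → DescentsContain (suc m) I J (c , p) →
    toℕ p ≤ firstIndex (block I (suc m)) (blockImage m I c)
  position≤firstIndex m I J c p v with DescentsContain⇒ValidInsertion m I J c p v | I m in eq
  ... | valid-insertion rest left-of-max _ | true  = subst (toℕ p ≤_) same-block (left-of-max eq)
    where
    same-block : positionOfMax m c ≡ firstIndex (block I m + 0) (blockImage m I c)
    same-block = trans (sym (firstIndex-blockImage m I (dropGap J (toℕ p)) c rest))
                       (cong (λ z → firstIndex z (blockImage m I c)) (sym (+-identityʳ (block I m))))
  ... | _ | false = subst (toℕ p ≤_) (sym new-block) (≤-pred (toℕ<n p))
    where
    new-block : firstIndex (block I m + 1) (blockImage m I c) ≡ suc m
    new-block = trans (firstIndex-absent (block I m + 1) (blockImage m I c) (block I m) (blockImage-≤ m I c)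
                        (subst (block I m <_) (sym (+-comm (block I m) 1)) ≤-refl))
                      (length-blockImage m I c)

blockImage-arrangement : ∀ m I J c → DescentsContain m I J c → Arrangement m I J (blockImage m I c)
blockImage-arrangement zero    I J tt      v = arrangement refl (λ _ → refl) (λ _ _ → z≤n)
blockImage-arrangement (suc m) I J (c , p) v with DescentsContain⇒ValidInsertion m I J c p v
... | valid-insertion rest _ no-gap-before = Arrangement-insertAt m I J (blockImage m I c) (toℕ p) (≤-pred (toℕ<n p))
  (blockImage-arrangement m I (dropGap J (toℕ p)) c rest) no-gap-before

blockImage-injective : ∀ m I J c₁ c₂ → DescentsContain m I J c₁ → DescentsContain m I J c₂ →
  blockImage m I c₁ ≡ blockImage m I c₂ → c₁ ≡ c₂
blockImage-injective zero    I J tt        tt        v₁ v₂ e = refl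
blockImage-injective (suc m) I J (c₁ , p₁) (c₂ , p₂) v₁ v₂ e =
  cong₂ _,_ (blockImage-injective m I (dropGap J (toℕ p₁)) c₁ c₂ rest₁ rest₂ same-image) (toℕ-injective same-position)
  where
  top = block I (suc m)
  ok₁ = position≤firstIndex m I J c₁ p₁ v₁
  ok₂ = position≤firstIndex m I J c₂ p₂ v₂
  same-position : toℕ p₁ ≡ toℕ p₂
  same-position = trans (sym (firstIndex-insertAt (toℕ p₁) top (blockImage m I c₁) ok₁))
                        (trans (cong (firstIndex top) e) (firstIndex-insertAt (toℕ p₂) top (blockImage m I c₂) ok₂))
  same-image : blockImage m I c₁ ≡ blockImage m I c₂
  same-image = trans (sym (deleteFirst-insertAt (toℕ p₁) top (blockImage m I c₁) ok₁))
                     (trans (cong (deleteFirst top) e) (deleteFirst-insertAt (toℕ p₂) top (blockImage m I c₂) ok₂))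
  rest₁ = ValidInsertion.rest (DescentsContain⇒ValidInsertion m I J c₁ p₁ v₁)
  rest₂ : DescentsContain m I (dropGap J (toℕ p₁)) c₂
  rest₂ = subst (λ z → DescentsContain m I (dropGap J z) c₂) (sym same-position)
                (ValidInsertion.rest (DescentsContain⇒ValidInsertion m I J c₂ p₂ v₂))

blockImage-surjective : ∀ m I J β → Arrangement m I J β →
  Σ (Code m) (λ c → DescentsContain m I J c × blockImage m I c ≡ β)
blockImage-surjective zero    I J (x ∷ []) (arrangement _ counts _) =
  tt , descents (λ _ ()) (λ _ ()) , cong [_] (sym (n≤0⇒n≡0 (count-pos⇒≤ x (0 ∷ []) 0 (z≤n ∷ []) x∈[0])))
  where
  x∈[0] : 1 ≤ count x (0 ∷ [])
  x∈[0] = subst (1 ≤_) (counts x) (subst (λ z → 1 ≤ z + 0) (sym (bit-≡ᵇ-refl x)) ≤-refl)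
blockImage-surjective (suc m) I J β v with Arrangement-deleteFirst m I J β v
... | v′ , no-gap-before , f<
  with blockImage-surjective m I (dropGap J (firstIndex (block I (suc m)) β)) (deleteFirst (block I (suc m)) β) v′
... | c , vc , image≡ = (c , p) , ValidInsertion⇒DescentsContain m I J c p valid , image≡β
  where
  top = block I (suc m)
  p : Fin (suc (suc m))
  p = fromℕ< f<
  p≡f : toℕ p ≡ firstIndex top β
  p≡f = toℕ-fromℕ< f<
  left-of-max : I m ≡ true → toℕ p ≤ positionOfMax m c
  left-of-max eq = subst (toℕ p ≤_) (sym (begin
    positionOfMax m c                                ≡⟨ firstIndex-blockImage m I _ c vc ⟨
    firstIndex (block I m) (blockImage m I c)        ≡⟨ cong (λ z → firstIndex z (blockImage m I c)) (block-member I m eq) ⟨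
    firstIndex top (blockImage m I c)                ≡⟨ cong (firstIndex top) image≡ ⟩
    firstIndex top (deleteFirst top β)               ∎))
    (subst (_≤ firstIndex top (deleteFirst top β)) (sym p≡f) (firstIndex-deleteFirst top β))
    where open ≡-Reasoning
  valid : ValidInsertion m I J c (toℕ p)
  valid = valid-insertion (subst (λ z → DescentsContain m I (dropGap J z) c) (sym p≡f) vc) left-of-max
                          (λ q e → no-gap-before q (trans e p≡f))
  image≡β : insertAt (toℕ p) top (blockImage m I c) ≡ β
  image≡β = trans (cong₂ (λ a b → insertAt a top b) p≡f image≡)
                  (insertAt-deleteFirst top β (count-top-block-pos m I β (Arrangement.counts≡ v)))

incrHead : List ℕ → List ℕ
incrHead []       = [ 1 ]
incrHead (x ∷ xs) = suc x ∷ xs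

-- The composition of n into the runs of 0, …, n-1 in which v and v+1 are joined iff I v; for the
-- predicate of a subset I ⊆ {1, …, n-1} (shifted down by one) this is [I]ₙ.
compositionOf : (ℕ → Bool) → ℕ → List ℕ
compositionOf I zero          = []
compositionOf I (suc zero)    = [ 1 ]
compositionOf I (suc (suc n)) =
  if I 0 then incrHead (compositionOf (I ∘ suc) (suc n)) else 1 ∷ compositionOf (I ∘ suc) (suc n)

compositionOf-head : ∀ I n → Σ ℕ (λ x → Σ (List ℕ) (λ xs → compositionOf I (suc n) ≡ suc x ∷ xs))
compositionOf-head I zero    = 0 , [] , refl
compositionOf-head I (suc n) with I 0
... | false = 0 , _ , refl
... | true with compositionOf-head (I ∘ suc) n
...   | x , xs , e = suc x , xs , cong incrHead e

sum-incrHead : ∀ xs → sum (incrHead xs) ≡ suc (sum xs)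
sum-incrHead []       = refl
sum-incrHead (x ∷ xs) = refl

sum-compositionOf : ∀ I n → sum (compositionOf I (suc n)) ≡ suc n
sum-compositionOf I zero    = refl
sum-compositionOf I (suc n) with I 0
... | true  = trans (sum-incrHead (compositionOf (I ∘ suc) (suc n))) (cong suc (sum-compositionOf (I ∘ suc) n))
... | false = cong suc (sum-compositionOf (I ∘ suc) n)

block-suc-∘suc : ∀ I v → block I (suc v) ≡ (if I 0 then 0 else 1) + block (I ∘ suc) v
block-suc-∘suc I zero    = +-comm 0 _
block-suc-∘suc I (suc v) = trans (cong (_+ (if I (suc v) then 0 else 1)) (block-suc-∘suc I v))
                                 (+-assoc (if I 0 then 0 else 1) (block (I ∘ suc) v) _)

length-incrHead : ∀ xs → 1 ≤ length xs → length (incrHead xs) ≡ length xs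
length-incrHead (x ∷ xs) h = refl

block-∘suc-member : ∀ I n → I 0 ≡ true → block I (suc n) ≡ block (I ∘ suc) n
block-∘suc-member I n e = trans (block-suc-∘suc I n) (cong (λ z → (if z then 0 else 1) + block (I ∘ suc) n) e)

block-∘suc-nonmember : ∀ I n → I 0 ≡ false → block I (suc n) ≡ suc (block (I ∘ suc) n)
block-∘suc-nonmember I n e = trans (block-suc-∘suc I n) (cong (λ z → (if z then 0 else 1) + block (I ∘ suc) n) e)

length-compositionOf-≥1 : ∀ I n → 1 ≤ length (compositionOf I (suc n))
length-compositionOf-≥1 I n = subst (λ z → 1 ≤ length z) (sym (proj₂ (proj₂ (compositionOf-head I n)))) (s≤s z≤n)

length-compositionOf : ∀ I n → length (compositionOf I (suc n)) ≡ suc (block I n)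
length-compositionOf I zero    = refl
length-compositionOf I (suc n) with I 0 in eq
... | true  = trans (length-incrHead (compositionOf (I ∘ suc) (suc n)) (length-compositionOf-≥1 (I ∘ suc) n))
                    (trans (length-compositionOf (I ∘ suc) n) (cong suc (sym (block-∘suc-member I n eq))))
... | false = cong suc (trans (length-compositionOf (I ∘ suc) n) (sym (block-∘suc-nonmember I n eq)))

count-map-suc : ∀ a L → count (suc a) (map suc L) ≡ count a L
count-map-suc a [] = refl
count-map-suc a (x ∷ L) = cong (bit (x ≡ᵇ a) +_) (count-map-suc a L)

count-zero-map-suc : ∀ L → count 0 (map suc L) ≡ 0
count-zero-map-suc [] = refl
count-zero-map-suc (x ∷ L) = count-zero-map-suc L

blockList-cons : ∀ I m → blockList I (suc m) ≡ 0 ∷ map (λ v → block I (suc v)) (range 0 (suc m))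
blockList-cons I m = cong (0 ∷_) (trans (cong (map (block I)) (range-suc 0 (suc m))) (sym (map-∘ (range 0 (suc m)))))

entry-incrHead : ∀ xs a → 1 ≤ length xs → entry (incrHead xs) a ≡ bit (0 ≡ᵇ a) + entry xs a
entry-incrHead (x ∷ xs) zero h = refl
entry-incrHead (x ∷ xs) (suc a) h = refl

count-blockList : ∀ I m a → count a (blockList I m) ≡ entry (compositionOf I (suc m)) a
count-blockList I zero    zero    = refl
count-blockList I zero    (suc a) = refl
count-blockList I (suc m) a = by-cases (I 0) refl
  where
  open ≡-Reasoning
  K = compositionOf (I ∘ suc) (suc m)
  U = range 0 (suc m)
  shifted : ∀ a → count a (0 ∷ map suc (blockList (I ∘ suc) m)) ≡ entry (1 ∷ K) a
  shifted zero    = cong suc (count-zero-map-suc (blockList (I ∘ suc) m))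
  shifted (suc a) = trans (count-map-suc a (blockList (I ∘ suc) m)) (count-blockList (I ∘ suc) m a)
  by-cases : ∀ b → I 0 ≡ b → count a (blockList I (suc m)) ≡ entry (if b then incrHead K else 1 ∷ K) a
  by-cases true e = begin
    count a (blockList I (suc m))
      ≡⟨ cong (count a) (blockList-cons I m) ⟩
    bit (0 ≡ᵇ a) + count a (map (λ v → block I (suc v)) U)
      ≡⟨ cong (λ z → bit (0 ≡ᵇ a) + count a z) (map-cong (λ v → block-∘suc-member I v e) U) ⟩
    bit (0 ≡ᵇ a) + count a (blockList (I ∘ suc) m)
      ≡⟨ cong (bit (0 ≡ᵇ a) +_) (count-blockList (I ∘ suc) m a) ⟩
    bit (0 ≡ᵇ a) + entry K a
      ≡⟨ entry-incrHead K a (length-compositionOf-≥1 (I ∘ suc) m) ⟨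
    entry (incrHead K) a ∎
  by-cases false e = begin
    count a (blockList I (suc m))
      ≡⟨ cong (count a) (blockList-cons I m) ⟩
    count a (0 ∷ map (λ v → block I (suc v)) U)
      ≡⟨ cong (λ z → count a (0 ∷ z)) (trans (map-cong (λ v → block-∘suc-nonmember I v e) U) (map-∘ U)) ⟩
    count a (0 ∷ map suc (blockList (I ∘ suc) m))
      ≡⟨ shifted a ⟩
    entry (1 ∷ K) a ∎

consHead : ℕ → List (List ℕ) → List (List ℕ)
consHead x []       = [ [ x ] ]
consHead x (c ∷ cs) = (x ∷ c) ∷ cs

pushSegment : Bool → ℕ → List (List ℕ) → List (List ℕ)
pushSegment true  x cs = consHead x cs
pushSegment false x cs = [ x ] ∷ cs

-- Cuts β at every gap j ∉ J, the gap j lying between the entries j and j+1.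
segments : (ℕ → Bool) → List ℕ → List (List ℕ)
segments J []          = []
segments J (x ∷ [])    = [ [ x ] ]
segments J (x ∷ y ∷ β) = pushSegment (J 0) x (segments (J ∘ suc) (y ∷ β))

segments-head : ∀ J y β →
  Σ (List ℕ) (λ c → Σ (List (List ℕ)) (λ cs → segments J (y ∷ β) ≡ (y ∷ c) ∷ cs))
segments-head J y []      = [] , [] , refl
segments-head J y (z ∷ β) with J 0
... | false = [] , _ , refl
... | true with segments-head (J ∘ suc) z β
...   | c , cs , e = (z ∷ c) , cs , cong (consHead y) e

concat-segments : ∀ J β → concat (segments J β) ≡ β
concat-segments J []          = refl
concat-segments J (x ∷ [])    = refl
concat-segments J (x ∷ y ∷ β) =
  trans (concat-pushSegment (J 0) (segments (J ∘ suc) (y ∷ β))) (cong (x ∷_) (concat-segments (J ∘ suc) (y ∷ β)))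
  where
  concat-pushSegment : ∀ b cs → concat (pushSegment b x cs) ≡ x ∷ concat cs
  concat-pushSegment true  []       = refl
  concat-pushSegment true  (c ∷ cs) = refl
  concat-pushSegment false cs       = refl

map-length-consHead : ∀ x cs → map length (consHead x cs) ≡ incrHead (map length cs)
map-length-consHead x []       = refl
map-length-consHead x (c ∷ cs) = refl

map-length-segments : ∀ J x β → map length (segments J (x ∷ β)) ≡ compositionOf J (suc (length β))
map-length-segments J x []      = refl
map-length-segments J x (y ∷ β) with J 0
... | true  = trans (map-length-consHead x _) (cong incrHead (map-length-segments (J ∘ suc) y β))
... | false = cong (1 ∷_) (map-length-segments (J ∘ suc) y β)

Descending : List ℕ → Set
Descending = Linked _≥_

segments-descending : ∀ J β → WeaklyDescendsOn J β → All Descending (segments J β)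
segments-descending J []          d = []
segments-descending J (x ∷ [])    d = [-] ∷ []
segments-descending J (x ∷ y ∷ β) d with J 0 in eq | segments-descending (J ∘ suc) (y ∷ β) (λ j → d (suc j))
... | false | ih = [-] ∷ ih
... | true  | ih with segments-head (J ∘ suc) y β
...   | c , cs , e with subst (All Descending) e ih
...     | yc ∷ rest = subst (λ z → All Descending (consHead x z)) (sym e) ((d 0 eq ∷ yc) ∷ rest)

segments-head-descending : ∀ J x y β → J 0 ≡ true → All Descending (segments J (x ∷ y ∷ β)) → y ≤ x
segments-head-descending J x y β e rewrite e with segments-head (J ∘ suc) y β
... | c , cs , hc rewrite hc = λ a → Linked.head (All.head a)

segments-tail-descending : ∀ J x y β → All Descending (segments J (x ∷ y ∷ β)) →
  All Descending (segments (J ∘ suc) (y ∷ β))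
segments-tail-descending J x y β with J 0
... | false = All.tail
... | true with segments-head (J ∘ suc) y β
...   | c , cs , hc rewrite hc = λ a → Linked.tail (All.head a) ∷ All.tail a

descending-segments⇒descendsOn : ∀ J β → All Descending (segments J β) → WeaklyDescendsOn J β
descending-segments⇒descendsOn J []          a j       e = z≤n
descending-segments⇒descendsOn J (x ∷ [])    a j       e = z≤n
descending-segments⇒descendsOn J (x ∷ y ∷ β) a zero    e = segments-head-descending J x y β e a
descending-segments⇒descendsOn J (x ∷ y ∷ β) a (suc j) e =
  descending-segments⇒descendsOn (J ∘ suc) (y ∷ β) (segments-tail-descending J x y β a) j e

length-concat : ∀ (Ls : List (List ℕ)) → length (concat Ls) ≡ sum (map length Ls)
length-concat []       = refl
length-concat (L ∷ Ls) = trans (length-++ L) (cong (length L +_) (length-concat Ls))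

count-++ : ∀ a L L′ → count a (L ++ L′) ≡ count a L + count a L′
count-++ a []      L′ = refl
count-++ a (x ∷ L) L′ = trans (cong (bit (x ≡ᵇ a) +_) (count-++ a L L′)) (sym (+-assoc (bit (x ≡ᵇ a)) _ _))

count-concat : ∀ a (Ls : List (List ℕ)) → count a (concat Ls) ≡ sum (map (count a) Ls)
count-concat a []       = refl
count-concat a (L ∷ Ls) = trans (count-++ a L (concat Ls)) (cong (count a L +_) (count-concat a Ls))

++-split-by-length : {A : Set} (L L′ : List A) {M M′ : List A} → length L ≡ length L′ →
  L ++ M ≡ L′ ++ M′ → (L ≡ L′) × (M ≡ M′)
++-split-by-length []      []        _   e = refl , e
++-split-by-length (x ∷ L) (x′ ∷ L′) len e with ∷-injective e
... | x≡x′ , rest with ++-split-by-length L L′ (suc-injective len) rest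
... | L≡L′ , M≡M′ = cong₂ _∷_ x≡x′ L≡L′ , M≡M′

concat-injective : {A : Set} (Ls Ls′ : List (List A)) → map length Ls ≡ map length Ls′ →
  concat Ls ≡ concat Ls′ → Ls ≡ Ls′
concat-injective []       []         _    _ = refl
concat-injective (L ∷ Ls) (L′ ∷ Ls′) lens e with ∷-injective lens
... | len , lens′ with ++-split-by-length L L′ len e
... | L≡L′ , rest = cong₂ _∷_ L≡L′ (concat-injective Ls Ls′ lens′ rest)

segments-concat : ∀ J n (Ls : List (List ℕ)) → map length Ls ≡ compositionOf J (suc n) → segments J (concat Ls) ≡ Ls
segments-concat J n Ls lens = concat-injective (segments J (concat Ls)) Ls
  (trans (lengths (concat Ls) length-β) (sym lens)) (concat-segments J (concat Ls))
  where
  length-β : length (concat Ls) ≡ suc n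
  length-β = trans (length-concat Ls) (trans (cong sum lens) (sum-compositionOf J n))
  lengths : ∀ β → length β ≡ suc n → map length (segments J β) ≡ compositionOf J (suc n)
  lengths (x ∷ β) refl = map-length-segments J x β

sumBelow : (ℕ → ℕ) → ℕ → ℕ
sumBelow g zero = 0
sumBelow g (suc k) = sumBelow g k + g k

sum-map-range : ∀ f k → sum (map f (range 0 k)) ≡ sumBelow f k
sum-map-range f zero = refl
sum-map-range f (suc k) = begin
  sum (map f (range 0 (suc k)))          ≡⟨ cong (λ z → sum (map f z)) (range-snoc 0 k) ⟩
  sum (map f (range 0 k ++ [ k ]))       ≡⟨ cong sum (map-++ f (range 0 k) [ k ]) ⟩
  sum (map f (range 0 k) ++ [ f k ])     ≡⟨ sum-++ (map f (range 0 k)) [ f k ] ⟩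
  sum (map f (range 0 k)) + (f k + 0)    ≡⟨ cong₂ _+_ (sum-map-range f k) (+-identityʳ (f k)) ⟩
  sumBelow f k + f k                     ∎
  where open ≡-Reasoning

sumBelow-+ : ∀ f g k → sumBelow (λ a → f a + g a) k ≡ sumBelow f k + sumBelow g k
sumBelow-+ f g zero = refl
sumBelow-+ f g (suc k) rewrite sumBelow-+ f g k = interchange (sumBelow f k) (sumBelow g k) (f k) (g k)

sumBelow-cong : ∀ f g k → (∀ a → a < k → f a ≡ g a) → sumBelow f k ≡ sumBelow g k
sumBelow-cong f g zero h = refl
sumBelow-cong f g (suc k) h = cong₂ _+_ (sumBelow-cong f g k (λ a q → h a (≤-trans q (n≤1+n k)))) (h k ≤-refl)

sumBelow-bit-≥ : ∀ x k → k ≤ x → sumBelow (λ a → bit (x ≡ᵇ a)) k ≡ 0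
sumBelow-bit-≥ x zero h = refl
sumBelow-bit-≥ x (suc k) h rewrite ≢⇒≡ᵇ≡false x k (λ e → <-irrefl (sym e) h) =
  trans (+-identityʳ _) (sumBelow-bit-≥ x k (≤-trans (n≤1+n k) h))

sumBelow-bit-< : ∀ x k → x < k → sumBelow (λ a → bit (x ≡ᵇ a)) k ≡ 1
sumBelow-bit-< x (suc k) h with m≤n⇒m<n∨m≡n (≤-pred h)
... | inj₂ refl rewrite ≡ᵇ-refl x = cong (_+ 1) (sumBelow-bit-≥ x x ≤-refl)
... | inj₁ lt rewrite ≢⇒≡ᵇ≡false x k (λ e → <-irrefl e lt) = trans (+-identityʳ _) (sumBelow-bit-< x k lt)

sumBelow-count : ∀ k C → All (_< k) C → sumBelow (λ a → count a C) k ≡ length C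
sumBelow-count k [] h = sumBelow-zero k
  where
  sumBelow-zero : ∀ k → sumBelow (λ _ → 0) k ≡ 0
  sumBelow-zero zero    = refl
  sumBelow-zero (suc k) = trans (+-identityʳ _) (sumBelow-zero k)
sumBelow-count k (x ∷ C) (hx ∷ h) =
  trans (sumBelow-+ (λ a → bit (x ≡ᵇ a)) (λ a → count a C) k) (cong₂ _+_ (sumBelow-bit-< x k hx) (sumBelow-count k C h))

descendingWord : ℕ → (ℕ → ℕ) → List ℕ
descendingWord zero g = []
descendingWord (suc k) g = replicate (g k) k ++ descendingWord k g

length-descendingWord : ∀ k g → length (descendingWord k g) ≡ sumBelow g k
length-descendingWord zero g = refl
length-descendingWord (suc k) g = trans (length-++ (replicate (g k) k))
  (trans (cong₂ _+_ (length-replicate (g k)) (length-descendingWord k g)) (+-comm (g k) _))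

count-replicate-≡ : ∀ a r → count a (replicate r a) ≡ r
count-replicate-≡ a zero = refl
count-replicate-≡ a (suc r) rewrite ≡ᵇ-refl a = cong suc (count-replicate-≡ a r)

count-replicate-≢ : ∀ a x r → x ≢ a → count a (replicate r x) ≡ 0
count-replicate-≢ a x zero h = refl
count-replicate-≢ a x (suc r) h rewrite ≢⇒≡ᵇ≡false x a h = count-replicate-≢ a x r h

descendingWord-< : ∀ k g → All (_< k) (descendingWord k g)
descendingWord-< zero g = []
descendingWord-< (suc k) g = ++⁺ (rep (g k)) (All.map (λ h → ≤-trans h (n≤1+n k)) (descendingWord-< k g))
  where
  rep : ∀ r → All (_< suc k) (replicate r k)
  rep zero = []
  rep (suc r) = ≤-refl ∷ rep r

count-absent : ∀ a C → All (_< a) C → count a C ≡ 0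
count-absent a [] h = refl
count-absent a (x ∷ C) (hx ∷ h) rewrite ≢⇒≡ᵇ≡false x a (λ e → <-irrefl e hx) = count-absent a C h

count-descendingWord-< : ∀ k g a → a < k → count a (descendingWord k g) ≡ g a
count-descendingWord-< (suc k) g a h with m≤n⇒m<n∨m≡n (≤-pred h)
... | inj₂ refl = trans (count-++ a (replicate (g a) a) (descendingWord a g))
  (trans (cong₂ _+_ (count-replicate-≡ a (g a)) (count-absent a (descendingWord a g) (descendingWord-< a g))) (+-identityʳ (g a)))
... | inj₁ lt = trans (count-++ a (replicate (g k) k) (descendingWord k g))
  (cong₂ _+_ (count-replicate-≢ a k (g k) (λ e → <-irrefl (sym e) lt)) (count-descendingWord-< k g a lt))

count-descendingWord-≥ : ∀ k g a → k ≤ a → count a (descendingWord k g) ≡ 0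
count-descendingWord-≥ k g a h = count-absent a (descendingWord k g) (All.map (λ q → ≤-trans q h) (descendingWord-< k g))

Descending-cons : ∀ x L → Descending L → All (_≤ x) L → Descending (x ∷ L)
Descending-cons x []      w a       = [-]
Descending-cons x (y ∷ L) w (h ∷ a) = h ∷ w

Descending-head-≥ : ∀ x L → Descending (x ∷ L) → All (_≤ x) L
Descending-head-≥ x []      w       = []
Descending-head-≥ x (y ∷ L) (h ∷ w) = Linked⇒All (λ p q → ≤-trans q p) h w

Descending-replicate : ∀ x r L → Descending L → All (_≤ x) L →
  Descending (replicate r x ++ L) × All (_≤ x) (replicate r x ++ L)
Descending-replicate x zero L w a = w , a
Descending-replicate x (suc r) L w a with Descending-replicate x r L w a
... | w′ , a′ = Descending-cons x _ w′ a′ , ≤-refl ∷ a′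

descendingWord-descending : ∀ k g → Descending (descendingWord k g)
descendingWord-descending zero g = []
descendingWord-descending (suc k) g = proj₁
  (Descending-replicate k (g k) (descendingWord k g) (descendingWord-descending k g) (All.map <⇒≤ (descendingWord-< k g)))

descendingWord-cong : ∀ k g g′ → (∀ a → a < k → g a ≡ g′ a) → descendingWord k g ≡ descendingWord k g′
descendingWord-cong zero g g′ h = refl
descendingWord-cong (suc k) g g′ h =
  cong₂ _++_ (cong (λ z → replicate z k) (h k ≤-refl)) (descendingWord-cong k g g′ (λ a q → h a (m<n⇒m<1+n q)))

descendingWord-count : ∀ k C → Descending C → All (_< k) C → descendingWord k (λ a → count a C) ≡ C
descendingWord-count zero    []      w a        = refl
descendingWord-count zero    (x ∷ C) w (() ∷ a)
descendingWord-count (suc k) C       w a        = peel C w a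
  where
  open ≡-Reasoning
  peel : ∀ C → Descending C → All (_< suc k) C → descendingWord (suc k) (λ a → count a C) ≡ C
  peel []      w a = descendingWord-count k [] [] []
  peel (x ∷ C) w (x<1+k ∷ a) with m≤n⇒m<n∨m≡n (≤-pred x<1+k)
  ... | inj₂ refl = begin
    replicate (count x (x ∷ C)) x ++ descendingWord x (λ b → count b (x ∷ C))
      ≡⟨ cong₂ (λ r d → replicate r x ++ d) (count-∷-≡ x C)
               (descendingWord-cong x _ _ (λ b b<x → count-∷-≢ x b C (>⇒≢ b<x))) ⟩
    x ∷ descendingWord (suc x) (λ b → count b C)
      ≡⟨ cong (x ∷_) (peel C (Linked.tail w) (All.map s≤s (Descending-head-≥ x C w))) ⟩
    x ∷ C ∎
  ... | inj₁ x<k = begin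
    replicate (count k (x ∷ C)) k ++ descendingWord k (λ b → count b (x ∷ C))
      ≡⟨ cong (λ r → replicate r k ++ descendingWord k (λ b → count b (x ∷ C))) (count-absent k (x ∷ C) below-k) ⟩
    descendingWord k (λ b → count b (x ∷ C))
      ≡⟨ descendingWord-count k (x ∷ C) w below-k ⟩
    x ∷ C ∎
    where
    below-k : All (_< k) (x ∷ C)
    below-k = x<k ∷ All.map (λ q → ≤-<-trans q x<k) (Descending-head-≥ x C w)

-- Matrices from segmented words

segmentAt : List (List ℕ) → ℕ → List ℕ
segmentAt [] b = []
segmentAt (c ∷ cs) zero = c
segmentAt (c ∷ cs) (suc b) = segmentAt cs b

extendByZero : {k : ℕ} → (Fin k → ℕ) → ℕ → ℕ
extendByZero {zero} g a = 0
extendByZero {suc k} g zero = g zero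
extendByZero {suc k} g (suc a) = extendByZero (λ i → g (suc i)) a

extendByZero-toℕ : ∀ {k} (g : Fin k → ℕ) i → extendByZero g (toℕ i) ≡ g i
extendByZero-toℕ {suc k} g zero = refl
extendByZero-toℕ {suc k} g (suc i) = extendByZero-toℕ (λ i → g (suc i)) i

extendByZero-cong : ∀ {k} (g g′ : Fin k → ℕ) → (∀ i → g i ≡ g′ i) →
  ∀ a → extendByZero g a ≡ extendByZero g′ a
extendByZero-cong {zero} g g′ h a = refl
extendByZero-cong {suc k} g g′ h zero = h zero
extendByZero-cong {suc k} g g′ h (suc a) = extendByZero-cong (λ i → g (suc i)) (λ i → g′ (suc i)) (λ i → h (suc i)) a

lookup≡entry : ∀ (xs : List ℕ) i → lookup xs i ≡ entry xs (toℕ i)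
lookup≡entry (x ∷ xs) zero = refl
lookup≡entry (x ∷ xs) (suc i) = lookup≡entry xs i

map-segmentAt-range : ∀ {B : Set} (f : List ℕ → B) Cs →
  map (λ b → f (segmentAt Cs b)) (range 0 (length Cs)) ≡ map f Cs
map-segmentAt-range f [] = refl
map-segmentAt-range f (c ∷ Cs) = cong (f c ∷_) (begin
  map (λ b → f (segmentAt (c ∷ Cs) b)) (range 1 (length Cs))
    ≡⟨ cong (map (λ b → f (segmentAt (c ∷ Cs) b))) (range-suc 0 (length Cs)) ⟩
  map (λ b → f (segmentAt (c ∷ Cs) b)) (map suc (range 0 (length Cs)))
    ≡⟨ map-∘ (range 0 (length Cs)) ⟨
  map (λ b → f (segmentAt Cs b)) (range 0 (length Cs))
    ≡⟨ map-segmentAt-range f Cs ⟩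
  map f Cs ∎)
  where open ≡-Reasoning

map-entry-range : ∀ (f : ℕ → ℕ) q → map (λ b → f (entry q b)) (range 0 (length q)) ≡ map f q
map-entry-range f [] = refl
map-entry-range f (c ∷ q) = cong (f c ∷_) (begin
  map (λ b → f (entry (c ∷ q) b)) (range 1 (length q))
    ≡⟨ cong (map (λ b → f (entry (c ∷ q) b))) (range-suc 0 (length q)) ⟩
  map (λ b → f (entry (c ∷ q) b)) (map suc (range 0 (length q)))
    ≡⟨ map-∘ (range 0 (length q)) ⟨
  map (λ b → f (entry q b)) (range 0 (length q))
    ≡⟨ map-entry-range f q ⟩
  map f q ∎)
  where open ≡-Reasoning

segmentAt-map-range : ∀ (f : ℕ → List ℕ) l b → b < l → segmentAt (map f (range 0 l)) b ≡ f b
segmentAt-map-range f (suc l) zero h = refl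
segmentAt-map-range f (suc l) (suc b) (s≤s h) = begin
  segmentAt (map f (range 1 l)) b          ≡⟨ cong (λ z → segmentAt (map f z) b) (range-suc 0 l) ⟩
  segmentAt (map f (map suc (range 0 l))) b ≡⟨ cong (λ z → segmentAt z b) (map-∘ (range 0 l)) ⟨
  segmentAt (map (f ∘ suc) (range 0 l)) b  ≡⟨ segmentAt-map-range (f ∘ suc) l b h ⟩
  f (suc b)                                ∎
  where open ≡-Reasoning

length-segmentAt : ∀ Cs b → length (segmentAt Cs b) ≡ entry (map length Cs) b
length-segmentAt [] b = refl
length-segmentAt (c ∷ Cs) zero = refl
length-segmentAt (c ∷ Cs) (suc b) = length-segmentAt Cs b

All-segmentAt-concat : ∀ {P : ℕ → Set} Cs b → All P (concat Cs) → All P (segmentAt Cs b)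
All-segmentAt-concat [] b a = []
All-segmentAt-concat (c ∷ Cs) zero a = ++⁻ˡ c a
All-segmentAt-concat (c ∷ Cs) (suc b) a = All-segmentAt-concat Cs b (++⁻ʳ c a)

entry-beyond : ∀ (xs : List ℕ) a → length xs ≤ a → entry xs a ≡ 0
entry-beyond [] a h = refl
entry-beyond (x ∷ xs) (suc a) (s≤s h) = entry-beyond xs a h

segmentMatrix : ∀ {k l} → (ℕ → Bool) → List ℕ → Matrix k l
segmentMatrix J β a b = count (toℕ a) (segmentAt (segments J β) (toℕ b))

column : ∀ {k l} → Matrix k l → ℕ → ℕ → ℕ
column M b a = extendByZero (λ i → extendByZero (M i) b) a

matrixWord : ∀ {k l} → Matrix k l → List ℕ
matrixWord {k} {l} M = concat (map (λ b → descendingWord k (column M b)) (range 0 l))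

column-toℕ : ∀ {k l} (M : Matrix k l) i j → column M (toℕ j) (toℕ i) ≡ M i j
column-toℕ M i j = trans (extendByZero-toℕ (λ i′ → extendByZero (M i′) (toℕ j)) i) (extendByZero-toℕ (M i) j)

column-fromℕ< : ∀ {k l} (M : Matrix k l) a b (ha : a < k) (hb : b < l) → column M b a ≡ M (fromℕ< ha) (fromℕ< hb)
column-fromℕ< M a b ha hb =
  trans (cong₂ (column M) (sym (toℕ-fromℕ< hb)) (sym (toℕ-fromℕ< ha))) (column-toℕ M (fromℕ< ha) (fromℕ< hb))

matrixWord-cong : ∀ {k l} (M M′ : Matrix k l) → M ≗M M′ → matrixWord M ≡ matrixWord M′
matrixWord-cong {k} {l} M M′ h =
  cong concat (map-cong (λ b → descendingWord-cong k (column M b) (column M′ b) (λ a _ → same-column b a)) (range 0 l))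
  where
  same-column : ∀ b a → column M b a ≡ column M′ b a
  same-column b = extendByZero-cong (λ i → extendByZero (M i) b) (λ i → extendByZero (M′ i) b)
                                    (λ i → extendByZero-cong (M i) (M′ i) (h i) b)

sum-map-zero : ∀ (f : ℕ → ℕ) L → All (λ b → f b ≡ 0) L → sum (map f L) ≡ 0
sum-map-zero f [] a = refl
sum-map-zero f (x ∷ L) (h ∷ a) = cong₂ _+_ h (sum-map-zero f L a)

All-segmentAt : ∀ {P : List ℕ → Set} Cs b → All P Cs → P [] → P (segmentAt Cs b)
All-segmentAt [] b a p = p
All-segmentAt (c ∷ Cs) zero (x ∷ a) p = x
All-segmentAt (c ∷ Cs) (suc b) (x ∷ a) p = All-segmentAt Cs b a p

-- Arrangements correspond to matrices with prescribed row and column sums: the entry (a, b) counts the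
-- letter a in the b-th segment, and a matrix is read back column by column into descending segments.
module ArrangementMatrix (m : ℕ) (I J : ℕ → Bool) where

  p q : List ℕ
  p = compositionOf I (suc m)
  q = compositionOf J (suc m)

  k l : ℕ
  k = length p
  l = length q

  Arrangement-< : ∀ {β} → Arrangement m I J β → All (_< k) β
  Arrangement-< {β} (arrangement _ counts _) = subst (λ z → All (_< z) β) (sym (length-compositionOf I m))
    (All.map s≤s (All-≤-of-same-counts β (blockList I m) (block I m) counts (blockList-≤ I m)))

  map-length-segments-arrangement : ∀ {β} → Arrangement m I J β → map length (segments J β) ≡ q
  map-length-segments-arrangement {x ∷ β} (arrangement len _ _) =
    trans (map-length-segments J x β) (cong (λ z → compositionOf J (suc z)) (suc-injective len))

  length-segments-arrangement : ∀ {β} → Arrangement m I J β → l ≡ length (segments J β)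
  length-segments-arrangement {β} v =
    trans (cong length (sym (map-length-segments-arrangement v))) (length-map length (segments J β))

  segmentMatrix-rowColSums : ∀ β → Arrangement m I J β → RowColSums p q (segmentMatrix J β)
  segmentMatrix-rowColSums β v = rows , cols
    where
    open ≡-Reasoning
    Cs = segments J β
    rows : ∀ i → sum (tabulate (λ j → segmentMatrix {k} {l} J β i j)) ≡ lookup p i
    rows i = begin
      sum (tabulate {n = l} (λ j → count (toℕ i) (segmentAt Cs (toℕ j))))
        ≡⟨ cong sum (tabulate-toℕ l (λ b → count (toℕ i) (segmentAt Cs b))) ⟩
      sum (map (λ b → count (toℕ i) (segmentAt Cs b)) (range 0 l))
        ≡⟨ cong (λ z → sum (map (λ b → count (toℕ i) (segmentAt Cs b)) (range 0 z))) (length-segments-arrangement v) ⟩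
      sum (map (λ b → count (toℕ i) (segmentAt Cs b)) (range 0 (length Cs)))
        ≡⟨ cong sum (map-segmentAt-range (count (toℕ i)) Cs) ⟩
      sum (map (count (toℕ i)) Cs)        ≡⟨ count-concat (toℕ i) Cs ⟨
      count (toℕ i) (concat Cs)           ≡⟨ cong (count (toℕ i)) (concat-segments J β) ⟩
      count (toℕ i) β                     ≡⟨ Arrangement.counts≡ v (toℕ i) ⟩
      count (toℕ i) (blockList I m)       ≡⟨ count-blockList I m (toℕ i) ⟩
      entry p (toℕ i)                     ≡⟨ lookup≡entry p i ⟨
      lookup p i                          ∎
    cols : ∀ j → sum (tabulate (λ i → segmentMatrix {k} {l} J β i j)) ≡ lookup q j
    cols j = begin
      sum (tabulate {n = k} (λ i → count (toℕ i) C))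
        ≡⟨ cong sum (tabulate-toℕ k (λ a → count a C)) ⟩
      sum (map (λ a → count a C) (range 0 k))
        ≡⟨ sum-map-range (λ a → count a C) k ⟩
      sumBelow (λ a → count a C) k
        ≡⟨ sumBelow-count k C (All-segmentAt-concat Cs (toℕ j) (subst (All (_< k)) (sym (concat-segments J β)) (Arrangement-< v))) ⟩
      length C
        ≡⟨ length-segmentAt Cs (toℕ j) ⟩
      entry (map length Cs) (toℕ j)
        ≡⟨ cong (λ z → entry z (toℕ j)) (map-length-segments-arrangement v) ⟩
      entry q (toℕ j)
        ≡⟨ lookup≡entry q j ⟨
      lookup q j ∎
      where C = segmentAt Cs (toℕ j)

  module _ (M : Matrix k l) (sums : RowColSums p q M) where

    columnWord : ℕ → List ℕ
    columnWord b = descendingWord k (column M b)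

    columnWords : List (List ℕ)
    columnWords = map columnWord (range 0 l)

    map-length-columnWords : map length columnWords ≡ q
    map-length-columnWords = begin
      map length (map columnWord (range 0 l))         ≡⟨ map-∘ (range 0 l) ⟨
      map (λ b → length (columnWord b)) (range 0 l)   ≡⟨ tabulate-toℕ l (λ b → length (columnWord b)) ⟨
      tabulate (λ j → length (columnWord (toℕ j)))    ≡⟨ tabulate-cong length-columnWord ⟩
      tabulate (lookup q)                             ≡⟨ tabulate-lookup q ⟩
      q                                               ∎
      where
      open ≡-Reasoning
      length-columnWord : ∀ j → length (columnWord (toℕ j)) ≡ lookup q j
      length-columnWord j = begin
        length (columnWord (toℕ j))                       ≡⟨ length-descendingWord k (column M (toℕ j)) ⟩
        sumBelow (column M (toℕ j)) k                     ≡⟨ sum-map-range (column M (toℕ j)) k ⟨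
        sum (map (column M (toℕ j)) (range 0 k))          ≡⟨ cong sum (tabulate-toℕ k (column M (toℕ j))) ⟨
        sum (tabulate {n = k} (λ i → column M (toℕ j) (toℕ i)))   ≡⟨ cong sum (tabulate-cong (λ i → column-toℕ M i j)) ⟩
        sum (tabulate (λ i → M i j))                      ≡⟨ proj₂ sums j ⟩
        lookup q j                                        ∎

    segments-matrixWord : segments J (matrixWord M) ≡ columnWords
    segments-matrixWord = segments-concat J m columnWords map-length-columnWords

    count-matrixWord : ∀ a → count a (matrixWord M) ≡ count a (blockList I m)
    count-matrixWord a with a <? k
    ... | yes a<k = begin
      count a (concat columnWords)
        ≡⟨ count-concat a columnWords ⟩
      sum (map (count a) (map columnWord (range 0 l)))
        ≡⟨ cong sum (map-∘ (range 0 l)) ⟨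
      sum (map (λ b → count a (columnWord b)) (range 0 l))
        ≡⟨ cong sum (map-cong (λ b → count-descendingWord-< k (column M b) a a<k) (range 0 l)) ⟩
      sum (map (λ b → column M b a) (range 0 l))
        ≡⟨ cong sum (tabulate-toℕ l (λ b → column M b a)) ⟨
      sum (tabulate {n = l} (λ j → column M (toℕ j) a))
        ≡⟨ cong sum (tabulate-cong (λ j → trans (cong (column M (toℕ j)) (sym (toℕ-fromℕ< a<k))) (column-toℕ M (fromℕ< a<k) j))) ⟩
      sum (tabulate (λ j → M (fromℕ< a<k) j))
        ≡⟨ proj₁ sums (fromℕ< a<k) ⟩
      lookup p (fromℕ< a<k)
        ≡⟨ lookup≡entry p (fromℕ< a<k) ⟩
      entry p (toℕ (fromℕ< a<k))
        ≡⟨ cong (entry p) (toℕ-fromℕ< a<k) ⟩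
      entry p a
        ≡⟨ count-blockList I m a ⟨
      count a (blockList I m) ∎
      where open ≡-Reasoning
    ... | no a≮k = begin
      count a (concat columnWords)                         ≡⟨ count-concat a columnWords ⟩
      sum (map (count a) (map columnWord (range 0 l)))     ≡⟨ cong sum (map-∘ (range 0 l)) ⟨
      sum (map (λ b → count a (columnWord b)) (range 0 l))
        ≡⟨ sum-map-zero _ (range 0 l) (All.universal (λ b → count-descendingWord-≥ k (column M b) a (≮⇒≥ a≮k)) _) ⟩
      0                                                    ≡⟨ entry-beyond p a (≮⇒≥ a≮k) ⟨
      entry p a                                            ≡⟨ count-blockList I m a ⟨
      count a (blockList I m)                              ∎
      where open ≡-Reasoning

    matrixWord-arrangement : Arrangement m I J (matrixWord M)
    matrixWord-arrangement = arrangement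
      (trans (length-concat columnWords) (trans (cong sum map-length-columnWords) (sum-compositionOf J m)))
      count-matrixWord
      (descending-segments⇒descendsOn J (matrixWord M) (subst (All Descending) (sym segments-matrixWord)
        (map⁺ (All.universal (λ b → descendingWord-descending k (column M b)) (range 0 l)))))

    segmentMatrix-matrixWord : segmentMatrix J (matrixWord M) ≗M M
    segmentMatrix-matrixWord i j = begin
      count (toℕ i) (segmentAt (segments J (matrixWord M)) (toℕ j))
        ≡⟨ cong (λ z → count (toℕ i) (segmentAt z (toℕ j))) segments-matrixWord ⟩
      count (toℕ i) (segmentAt columnWords (toℕ j))
        ≡⟨ cong (count (toℕ i)) (segmentAt-map-range columnWord l (toℕ j) (toℕ<n j)) ⟩
      count (toℕ i) (columnWord (toℕ j))
        ≡⟨ count-descendingWord-< k (column M (toℕ j)) (toℕ i) (toℕ<n i) ⟩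
      column M (toℕ j) (toℕ i)
        ≡⟨ column-toℕ M i j ⟩
      M i j ∎
      where open ≡-Reasoning

  matrixWord-segmentMatrix : ∀ β → Arrangement m I J β → matrixWord (segmentMatrix {k} {l} J β) ≡ β
  matrixWord-segmentMatrix β v = begin
    concat (map (λ b → descendingWord k (column N b)) (range 0 l))
      ≡⟨ cong concat (map-cong-local (All.map (λ {b} → column-segment b) (range-< 0 l))) ⟩
    concat (map (segmentAt Cs) (range 0 l))
      ≡⟨ cong (λ z → concat (map (segmentAt Cs) (range 0 z))) (length-segments-arrangement v) ⟩
    concat (map (segmentAt Cs) (range 0 (length Cs)))
      ≡⟨ cong concat (trans (map-segmentAt-range (λ c → c) Cs) (map-id Cs)) ⟩
    concat Cs
      ≡⟨ concat-segments J β ⟩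
    β ∎
    where
    open ≡-Reasoning
    Cs = segments J β
    N = segmentMatrix {k} {l} J β
    column-segment : ∀ b → b < l → descendingWord k (column N b) ≡ segmentAt Cs b
    column-segment b b<l = trans
      (descendingWord-cong k _ _ (λ a a<k → trans (column-fromℕ< N a b a<k b<l)
        (cong₂ (λ x y → count x (segmentAt Cs y)) (toℕ-fromℕ< a<k) (toℕ-fromℕ< b<l))))
      (descendingWord-count k (segmentAt Cs b) (All-segmentAt Cs b (segments-descending J β (Arrangement.descends v)) [])
        (All-segmentAt-concat Cs b (subst (All (_< k)) (sym (concat-segments J β)) (Arrangement-< v))))

#Code : ℕ → ℕ
#Code zero    = 1
#Code (suc m) = #Code m * suc (suc m)

decodeCode : ∀ m → Fin (#Code m) → Code m
decodeCode zero    i = tt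
decodeCode (suc m) i = decodeCode m (proj₁ (remQuot {#Code m} (suc (suc m)) i)) , proj₂ (remQuot {#Code m} (suc (suc m)) i)

decodeCode-injective : ∀ m i i′ → decodeCode m i ≡ decodeCode m i′ → i ≡ i′
decodeCode-injective zero    zero zero e = refl
decodeCode-injective (suc m) i    i′   e = begin
  i                                          ≡⟨ combine-remQuot {#Code m} (suc (suc m)) i ⟨
  uncurry combine (remQuot {#Code m} (suc (suc m)) i)  ≡⟨ cong (uncurry combine) same-remQuot ⟩
  uncurry combine (remQuot {#Code m} (suc (suc m)) i′) ≡⟨ combine-remQuot {#Code m} (suc (suc m)) i′ ⟩
  i′                                         ∎
  where
  open ≡-Reasoning
  same-remQuot : remQuot {#Code m} (suc (suc m)) i ≡ remQuot {#Code m} (suc (suc m)) i′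
  same-remQuot = cong₂ _,_ (decodeCode-injective m _ _ (cong proj₁ e)) (cong proj₂ e)

decodeCode-surjective : ∀ m (c : Code m) → Σ (Fin (#Code m)) (λ i → decodeCode m i ≡ c)
decodeCode-surjective zero    tt      = zero , refl
decodeCode-surjective (suc m) (c , p) with decodeCode-surjective m c
... | j , e = combine j p ,
  trans (cong (λ z → decodeCode m (proj₁ z) , proj₂ z) (remQuot-combine {#Code m} {suc (suc m)} j p)) (cong (_, p) e)

filter-count : ∀ N (Q : Fin N → Set) → (∀ k → Dec (Q k)) → Σ ℕ (Counts _≡_ Q)
filter-count zero    Q Q? = 0 , record { elem = λ () ; valid = λ () ; distinct = λ () ; cover = λ () }
filter-count (suc N) Q Q? with filter-count N (λ k → Q (suc k)) (λ k → Q? (suc k)) | Q? zero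
... | N′ , c | yes q₀ = suc N′ , record { elem = elem′ ; valid = valid′ ; distinct = distinct′ ; cover = cover′ }
  where
  open Counts c
  elem′ : Fin (suc N′) → Fin (suc N)
  elem′ zero    = zero
  elem′ (suc k) = suc (elem k)
  valid′ : ∀ k → Q (elem′ k)
  valid′ zero    = q₀
  valid′ (suc k) = valid k
  distinct′ : ∀ k k′ → elem′ k ≡ elem′ k′ → k ≡ k′
  distinct′ zero    zero     e = refl
  distinct′ (suc k) (suc k′) e = cong suc (distinct k k′ (Fin.suc-injective e))
  cover′ : ∀ x → Q x → Σ (Fin (suc N′)) (λ k → elem′ k ≡ x)
  cover′ zero    q = zero , refl
  cover′ (suc x) q with cover x q
  ... | k , e = suc k , cong suc e
... | N′ , c | no ¬q₀ = N′ , record { elem = suc ∘ elem ; valid = valid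
                                    ; distinct = λ k k′ e → distinct k k′ (Fin.suc-injective e) ; cover = cover′ }
  where
  open Counts c
  cover′ : ∀ x → Q x → Σ (Fin N′) (λ k → suc (elem k) ≡ x)
  cover′ zero    q = ⊥-elim (¬q₀ q)
  cover′ (suc x) q with cover x q
  ... | k , e = k , cong suc e

Code-count : ∀ m (V : Code m → Set) → (∀ c → Dec (V c)) → Σ ℕ (Counts _≡_ V)
Code-count m V V? with filter-count (#Code m) (λ i → V (decodeCode m i)) (λ i → V? (decodeCode m i))
... | N , c = N , record
  { elem     = λ k → decodeCode m (elem k)
  ; valid    = valid
  ; distinct = λ k k′ e → distinct k k′ (decodeCode-injective m _ _ e)
  ; cover    = cover′ }
  where
  open Counts c
  cover′ : ∀ x → V x → Σ (Fin N) (λ k → decodeCode m (elem k) ≡ x)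
  cover′ x v with decodeCode-surjective m x
  ... | i , e with cover i (subst V (sym e) v)
  ... | k , e′ = k , trans (cong (decodeCode m) e′) e

module _ {A : Set} (_~_ : A → A → Set) (~-sym : ∀ {x y} → x ~ y → y ~ x)
         (~-trans : ∀ {x y z} → x ~ y → y ~ z → x ~ z) where

  Counts-≤ : ∀ {P Q : A → Set} {N N′} → Counts _~_ P N → Counts _~_ Q N′ → (∀ x → P x → Q x) → N ≤ N′
  Counts-≤ {N = N} {N′} c c′ P⇒Q = injective⇒≤ {f = index} index-injective
    where
    open Counts
    index : Fin N → Fin N′
    index k = proj₁ (cover c′ (elem c k) (P⇒Q _ (valid c k)))
    index-correct : ∀ k → elem c′ (index k) ~ elem c k
    index-correct k = proj₂ (cover c′ (elem c k) (P⇒Q _ (valid c k)))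
    index-injective : ∀ {k k′} → index k ≡ index k′ → k ≡ k′
    index-injective {k} {k′} e = distinct c k k′
      (~-trans (~-sym (index-correct k)) (subst (λ z → elem c′ z ~ elem c k′) (sym e) (index-correct k′)))

  Counts-unique : ∀ {P Q : A → Set} {N N′} → Counts _~_ P N → Counts _~_ Q N′ →
    (∀ x → P x → Q x) → (∀ x → Q x → P x) → N ≡ N′
  Counts-unique c c′ P⇒Q Q⇒P = ≤-antisym (Counts-≤ c c′ P⇒Q) (Counts-≤ c′ c Q⇒P)

Counts-⇔ : {A : Set} {P Q : A → Set} {N : ℕ} → Counts _≡_ P N →
  (∀ x → P x → Q x) → (∀ x → Q x → P x) → Counts _≡_ Q N
Counts-⇔ c P⇒Q Q⇒P = record
  { elem = elem ; valid = λ k → P⇒Q _ (valid k) ; distinct = distinct ; cover = λ x q → cover x (Q⇒P x q) }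
  where open Counts c

Counts-∅ : {A : Set} {P : A → Set} → (∀ x → ¬ P x) → Counts _≡_ P 0
Counts-∅ ¬P = record { elem = λ () ; valid = λ () ; distinct = λ () ; cover = λ x p → ⊥-elim (¬P x p) }

Counts-⊎ : {A : Set} {P Q : A → Set} {N N′ : ℕ} → Counts _≡_ P N → Counts _≡_ Q N′ →
  (∀ x → P x → ¬ Q x) → Counts _≡_ (λ x → P x ⊎ Q x) (N + N′)
Counts-⊎ {A} {P} {Q} {N} {N′} cP cQ disjoint = record
  { elem = pick ∘ splitAt N ; valid = valid′ ∘ splitAt N ; distinct = distinct′ ; cover = cover′ }
  where
  open Counts
  pick : Fin N ⊎ Fin N′ → A
  pick (inj₁ i) = elem cP i
  pick (inj₂ j) = elem cQ j
  valid′ : ∀ s → P (pick s) ⊎ Q (pick s)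
  valid′ (inj₁ i) = inj₁ (valid cP i)
  valid′ (inj₂ j) = inj₂ (valid cQ j)
  pick-injective : ∀ s s′ → pick s ≡ pick s′ → s ≡ s′
  pick-injective (inj₁ i) (inj₁ i′) e = cong inj₁ (distinct cP i i′ e)
  pick-injective (inj₂ j) (inj₂ j′) e = cong inj₂ (distinct cQ j j′ e)
  pick-injective (inj₁ i) (inj₂ j)  e = ⊥-elim (disjoint _ (valid cP i) (subst Q (sym e) (valid cQ j)))
  pick-injective (inj₂ j) (inj₁ i)  e = ⊥-elim (disjoint _ (valid cP i) (subst Q e (valid cQ j)))
  distinct′ : ∀ k k′ → pick (splitAt N k) ≡ pick (splitAt N k′) → k ≡ k′
  distinct′ k k′ e = begin
    k                          ≡⟨ join-splitAt N N′ k ⟨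
    join N N′ (splitAt N k)    ≡⟨ cong (join N N′) (pick-injective (splitAt N k) (splitAt N k′) e) ⟩
    join N N′ (splitAt N k′)   ≡⟨ join-splitAt N N′ k′ ⟩
    k′                         ∎
    where open ≡-Reasoning
  cover′ : ∀ x → P x ⊎ Q x → Σ (Fin (N + N′)) (λ k → pick (splitAt N k) ≡ x)
  cover′ x (inj₁ p) with cover cP x p
  ... | i , e = join N N′ (inj₁ i) , trans (cong pick (splitAt-join N N′ (inj₁ i))) e
  cover′ x (inj₂ q) with cover cQ x q
  ... | j , e = join N N′ (inj₂ j) , trans (cong pick (splitAt-join N N′ (inj₂ j))) e

Counts-⋃ : {A : Set} (k : ℕ) (size : ℕ → ℕ) (S : ℕ → A → Set) →
  (∀ x → x < k → Counts _≡_ (S x) (size x)) → (∀ x x′ a → S x a → S x′ a → x ≡ x′) →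
  Counts _≡_ (λ a → Σ ℕ (λ x → x < k × S x a)) (sumBelow size k)
Counts-⋃ zero    size S c disjoint = Counts-∅ (λ { a (x , () , _) })
Counts-⋃ (suc k) size S c disjoint = Counts-⇔
  (Counts-⊎ (Counts-⋃ k size S (λ x x<k → c x (m<n⇒m<1+n x<k)) disjoint) (c k ≤-refl) below-k-disjoint)
  forth back
  where
  below-k-disjoint : ∀ a → Σ ℕ (λ x → x < k × S x a) → ¬ S k a
  below-k-disjoint a (x , x<k , s) s′ = <-irrefl (disjoint x k a s s′) x<k
  forth : ∀ a → Σ ℕ (λ x → x < k × S x a) ⊎ S k a → Σ ℕ (λ x → x < suc k × S x a)
  forth a (inj₁ (x , x<k , s)) = x , m<n⇒m<1+n x<k , s
  forth a (inj₂ s)             = k , ≤-refl , s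
  back : ∀ a → Σ ℕ (λ x → x < suc k × S x a) → Σ ℕ (λ x → x < k × S x a) ⊎ S k a
  back a (x , x<1+k , s) with m≤n⇒m<n∨m≡n (≤-pred x<1+k)
  ... | inj₁ x<k  = inj₁ (x , x<k , s)
  ... | inj₂ refl = inj₂ s

-- The multinomial coefficient

HasContent : List ℕ → List ℕ → Set
HasContent κ β = (length β ≡ sum κ) × (∀ a → count a β ≡ entry κ a)

decrementAt : ℕ → List ℕ → List ℕ
decrementAt x       []      = []
decrementAt zero    (a ∷ κ) = pred a ∷ κ
decrementAt (suc x) (a ∷ κ) = a ∷ decrementAt x κ

entry-decrementAt-≡ : ∀ x κ → 1 ≤ entry κ x → suc (entry (decrementAt x κ) x) ≡ entry κ x
entry-decrementAt-≡ zero    (suc a ∷ κ) h = refl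
entry-decrementAt-≡ (suc x) (a ∷ κ)     h = entry-decrementAt-≡ x κ h

entry-decrementAt-≢ : ∀ x κ a → x ≢ a → entry (decrementAt x κ) a ≡ entry κ a
entry-decrementAt-≢ x       []      a       h = refl
entry-decrementAt-≢ zero    (b ∷ κ) zero    h = ⊥-elim (h refl)
entry-decrementAt-≢ zero    (b ∷ κ) (suc a) h = refl
entry-decrementAt-≢ (suc x) (b ∷ κ) zero    h = refl
entry-decrementAt-≢ (suc x) (b ∷ κ) (suc a) h = entry-decrementAt-≢ x κ a (h ∘ cong suc)

sum-decrementAt : ∀ x κ → 1 ≤ entry κ x → suc (sum (decrementAt x κ)) ≡ sum κ
sum-decrementAt zero    (suc a ∷ κ) h = refl
sum-decrementAt (suc x) (a ∷ κ)     h = trans (sym (+-suc a (sum (decrementAt x κ)))) (cong (a +_) (sum-decrementAt x κ h))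

product-decrementAt : ∀ x κ → 1 ≤ entry κ x → product (map _! κ) ≡ entry κ x * product (map _! (decrementAt x κ))
product-decrementAt zero    (suc a ∷ κ) h = *-assoc (suc a) (a !) _
product-decrementAt (suc x) (a ∷ κ)     h =
  trans (cong (a ! *_) (product-decrementAt x κ h)) (x∙yz≈y∙xz* (a !) (entry κ x) (product (map _! (decrementAt x κ))))

entry-sum≡0 : ∀ κ a → sum κ ≡ 0 → entry κ a ≡ 0
entry-sum≡0 []       a       h = refl
entry-sum≡0 (0 ∷ κ)  zero    h = refl
entry-sum≡0 (0 ∷ κ)  (suc a) h = entry-sum≡0 κ a h

product-factorial-sum≡0 : ∀ κ → sum κ ≡ 0 → product (map _! κ) ≡ 1
product-factorial-sum≡0 []      h = refl
product-factorial-sum≡0 (0 ∷ κ) h = trans (+-identityʳ _) (product-factorial-sum≡0 κ h)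

sumBelow-* : ∀ f c k → sumBelow (λ x → f x * c) k ≡ sumBelow f k * c
sumBelow-* f c zero    = refl
sumBelow-* f c (suc k) = trans (cong (_+ f k * c) (sumBelow-* f c k)) (sym (*-distribʳ-+ c (sumBelow f k) (f k)))

sumBelow-entry : ∀ κ → sumBelow (entry κ) (length κ) ≡ sum κ
sumBelow-entry κ =
  trans (sym (sum-map-range (entry κ) (length κ))) (cong sum (trans (map-entry-range (λ z → z) κ) (map-id κ)))

-- Counts the words of length n and content κ by their first letter.
multinomial : ℕ → List ℕ → ℕ
multinomial zero    κ = 1
multinomial (suc n) κ = sumBelow (λ x → if 0 <ᵇ entry κ x then multinomial n (decrementAt x κ) else 0) (length κ)

multinomial-formula : ∀ n κ → sum κ ≡ n → multinomial n κ * product (map _! κ) ≡ n !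
multinomial-formula zero    κ h = trans (+-identityʳ _) (product-factorial-sum≡0 κ h)
multinomial-formula (suc n) κ h = begin
  sumBelow F (length κ) * P
    ≡⟨ sumBelow-* F P (length κ) ⟨
  sumBelow (λ x → F x * P) (length κ)
    ≡⟨ sumBelow-cong (λ x → F x * P) (λ x → entry κ x * n !) (length κ) (λ x _ → term x) ⟩
  sumBelow (λ x → entry κ x * n !) (length κ)
    ≡⟨ sumBelow-* (entry κ) (n !) (length κ) ⟩
  sumBelow (entry κ) (length κ) * n !
    ≡⟨ cong (_* n !) (trans (sumBelow-entry κ) h) ⟩
  suc n * n ! ∎
  where
  open ≡-Reasoning
  F : ℕ → ℕ
  F x = if 0 <ᵇ entry κ x then multinomial n (decrementAt x κ) else 0
  P = product (map _! κ)
  term : ∀ x → F x * P ≡ entry κ x * n !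
  term x with entry κ x in eq
  ... | zero  = refl
  ... | suc g = begin
    multinomial n κ′ * P
      ≡⟨ cong (multinomial n κ′ *_) (trans (product-decrementAt x κ 1≤κx) (cong (_* P′) eq)) ⟩
    multinomial n κ′ * (suc g * P′)
      ≡⟨ x∙yz≈y∙xz* (multinomial n κ′) (suc g) P′ ⟩
    suc g * (multinomial n κ′ * P′)
      ≡⟨ cong (suc g *_) (multinomial-formula n κ′ (suc-injective (trans (sum-decrementAt x κ 1≤κx) h))) ⟩
    suc g * n ! ∎
    where
    1≤κx : 1 ≤ entry κ x
    1≤κx = subst (1 ≤_) (sym eq) (s≤s z≤n)
    κ′ = decrementAt x κ
    P′ = product (map _! κ′)

HasContent-∷ : ∀ κ x β → 1 ≤ entry κ x → HasContent (decrementAt x κ) β → HasContent κ (x ∷ β)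
HasContent-∷ κ x β 1≤κx (len , counts) = trans (cong suc len) (sum-decrementAt x κ 1≤κx) , counts′
  where
  counts′ : ∀ a → count a (x ∷ β) ≡ entry κ a
  counts′ a with x ≟ a
  ... | yes refl = trans (count-∷-≡ x β) (trans (cong suc (counts x)) (entry-decrementAt-≡ x κ 1≤κx))
  ... | no x≢a   = trans (count-∷-≢ x a β x≢a) (trans (counts a) (entry-decrementAt-≢ x κ a x≢a))

HasContent-∷⁻ : ∀ κ x β → HasContent κ (x ∷ β) → (1 ≤ entry κ x) × HasContent (decrementAt x κ) β
HasContent-∷⁻ κ x β (len , counts) = 1≤κx , suc-injective (trans len (sym (sum-decrementAt x κ 1≤κx))) , counts′
  where
  1≤κx : 1 ≤ entry κ x
  1≤κx = subst (1 ≤_) (trans (sym (count-∷-≡ x β)) (counts x)) (s≤s z≤n)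
  counts′ : ∀ a → count a β ≡ entry (decrementAt x κ) a
  counts′ a with x ≟ a
  ... | yes refl = suc-injective (trans (sym (count-∷-≡ x β)) (trans (counts x) (sym (entry-decrementAt-≡ x κ 1≤κx))))
  ... | no x≢a   = trans (sym (count-∷-≢ x a β x≢a)) (trans (counts a) (sym (entry-decrementAt-≢ x κ a x≢a)))

entry-pos⇒< : ∀ κ x → 1 ≤ entry κ x → x < length κ
entry-pos⇒< κ x 1≤κx with x <? length κ
... | yes x<len = x<len
... | no x≮len  = ⊥-elim (<-irrefl (sym (entry-beyond κ x (≮⇒≥ x≮len))) 1≤κx)

StartsWith : List ℕ → ℕ → List ℕ → Set
StartsWith κ x β = (1 ≤ entry κ x) × Σ (List ℕ) (λ β′ → (β ≡ x ∷ β′) × HasContent (decrementAt x κ) β′)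

content-count : ∀ n κ → sum κ ≡ n → Counts _≡_ (HasContent κ) (multinomial n κ)
content-count zero κ h = record
  { elem = λ _ → [] ; valid = λ _ → sym h , (λ a → sym (entry-sum≡0 κ a h))
  ; distinct = λ { zero zero _ → refl } ; cover = cover′ }
  where
  cover′ : ∀ β → HasContent κ β → Σ (Fin 1) (λ _ → [] ≡ β)
  cover′ []      _         = zero , refl
  cover′ (_ ∷ _) (len , _) = ⊥-elim (1+n≢0 (trans len h))
content-count (suc n) κ h = Counts-⇔ (Counts-⋃ (length κ) size (StartsWith κ) starting-with first-letter-unique) forth back
  where
  size : ℕ → ℕ
  size x = if 0 <ᵇ entry κ x then multinomial n (decrementAt x κ) else 0
  starting-with′ : ∀ x e → entry κ x ≡ e →
    Counts _≡_ (StartsWith κ x) (if 0 <ᵇ e then multinomial n (decrementAt x κ) else 0)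
  starting-with′ x zero    eq = Counts-∅ (λ β s → n≮0 (subst (1 ≤_) eq (proj₁ s)))
  starting-with′ x (suc g) eq = record
    { elem = λ k → x ∷ elem k ; valid = λ k → 1≤κx , elem k , refl , valid k
    ; distinct = λ k k′ e → distinct k k′ (proj₂ (∷-injective e)) ; cover = cover′ }
    where
    1≤κx : 1 ≤ entry κ x
    1≤κx = subst (1 ≤_) (sym eq) (s≤s z≤n)
    open Counts (content-count n (decrementAt x κ) (suc-injective (trans (sum-decrementAt x κ 1≤κx) h)))
    cover′ : ∀ β → StartsWith κ x β → Σ (Fin (multinomial n (decrementAt x κ))) (λ k → x ∷ elem k ≡ β)
    cover′ β (_ , β′ , refl , content) with cover β′ content
    ... | k , e = k , cong (x ∷_) e
  starting-with : ∀ x → x < length κ → Counts _≡_ (StartsWith κ x) (size x)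
  starting-with x _ = starting-with′ x (entry κ x) refl
  first-letter-unique : ∀ x x′ β → StartsWith κ x β → StartsWith κ x′ β → x ≡ x′
  first-letter-unique x x′ β (_ , _ , refl , _) (_ , _ , e , _) = proj₁ (∷-injective e)
  forth : ∀ β → Σ ℕ (λ x → x < length κ × StartsWith κ x β) → HasContent κ β
  forth β (x , _ , 1≤κx , β′ , refl , content) = HasContent-∷ κ x β′ 1≤κx content
  back : ∀ β → HasContent κ β → Σ ℕ (λ x → x < length κ × StartsWith κ x β)
  back []       (len , _) = ⊥-elim (0≢1+n (trans len h))
  back (x ∷ β′) content with HasContent-∷⁻ κ x β′ content
  ... | 1≤κx , content′ = x , entry-pos⇒< κ x 1≤κx , 1≤κx , β′ , refl , content′

toPred : Subset m → ℕ → Bool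
toPred []      j       = false
toPred (b ∷ I) zero    = b
toPred (b ∷ I) (suc j) = toPred I j

∈⇒toPred : (I : Subset m) (i : Fin m) → i ∈ I → toPred I (toℕ i) ≡ true
∈⇒toPred (b ∷ I) zero    here      = refl
∈⇒toPred (b ∷ I) (suc i) (there p) = ∈⇒toPred I i p

toPred⇒∈ : (I : Subset m) (i : Fin m) → toPred I (toℕ i) ≡ true → i ∈ I
toPred⇒∈ (true ∷ I) zero    e = here
toPred⇒∈ (b ∷ I)    (suc i) e = there (toPred⇒∈ I i e)

toPred-⊥ : ∀ m j → toPred (⊥ {m}) j ≡ false
toPred-⊥ zero    j       = refl
toPred-⊥ (suc m) zero    = refl
toPred-⊥ (suc m) (suc j) = toPred-⊥ m j

diffs-map-suc : ∀ a X → diffs (suc a) (map suc X) ≡ diffs a X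
diffs-map-suc a []      = refl
diffs-map-suc a (x ∷ X) = cong (x ∸ a ∷_) (diffs-map-suc x X)

complementStep : Subset m → Fin m → List ℕ
complementStep I i = if vlookup I i then [] else [ suc (toℕ i) ]

complementList-cons : ∀ b (I : Subset m) →
  complementList (suc m) (b ∷ I) ≡ (if b then [] else [ 1 ]) ++ map suc (complementList m I)
complementList-cons {m} b I = begin
  (B ++ concat (map (complementStep (b ∷ I)) (tabulate suc))) ++ [ suc (suc m) ]
    ≡⟨ cong (λ z → (B ++ z) ++ [ suc (suc m) ]) middle ⟩
  (B ++ map suc C) ++ [ suc (suc m) ]     ≡⟨ ++-assoc B (map suc C) [ suc (suc m) ] ⟩
  B ++ map suc C ++ [ suc (suc m) ]       ≡⟨ cong (B ++_) (map-++ suc C [ suc m ]) ⟨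
  B ++ map suc (C ++ [ suc m ])           ∎
  where
  open ≡-Reasoning
  B = if b then [] else [ 1 ]
  C = concat (map (complementStep I) (allFin m))
  step-suc : ∀ i → complementStep (b ∷ I) (suc i) ≡ map suc (complementStep I i)
  step-suc i with vlookup I i
  ... | true  = refl
  ... | false = refl
  middle : concat (map (complementStep (b ∷ I)) (tabulate suc)) ≡ map suc C
  middle = trans (cong concat (trans (map-tabulate suc (complementStep (b ∷ I)))
                                     (trans (tabulate-cong step-suc) (sym (map-tabulate (complementStep I) (map suc))))))
                 (trans (concat-map (tabulate (complementStep I)))
                        (cong (λ z → map suc (concat z)) (sym (map-tabulate (λ i → i) (complementStep I)))))

complementList-nonempty : (I : Subset m) → Σ ℕ (λ x → Σ (List ℕ) (λ X → complementList m I ≡ x ∷ X))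
complementList-nonempty {m} I with concat (map (complementStep I) (allFin m))
... | []    = suc m , [] , refl
... | y ∷ Y = y , Y ++ [ suc m ] , refl

composition≡compositionOf : ∀ m (I : Subset m) → composition m I ≡ compositionOf (toPred I) (suc m)
composition≡compositionOf zero    []          = refl
composition≡compositionOf (suc m) (false ∷ I) =
  trans (cong (diffs 0) (complementList-cons false I))
        (cong (1 ∷_) (trans (diffs-map-suc 0 (complementList m I)) (composition≡compositionOf m I)))
composition≡compositionOf (suc m) (true ∷ I) with complementList-nonempty I
... | x , X , e = begin
  diffs 0 (complementList (suc m) (true ∷ I)) ≡⟨ cong (diffs 0) (complementList-cons true I) ⟩
  diffs 0 (map suc (complementList m I))      ≡⟨ cong (λ z → diffs 0 (map suc z)) e ⟩
  suc x ∷ diffs (suc x) (map suc X)           ≡⟨ cong (suc x ∷_) (diffs-map-suc x X) ⟩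
  incrHead (diffs 0 (x ∷ X))                  ≡⟨ cong (λ z → incrHead (diffs 0 z)) e ⟨
  incrHead (composition m I)                  ≡⟨ cong incrHead (composition≡compositionOf m I) ⟩
  incrHead (compositionOf (toPred I) (suc m)) ∎
  where open ≡-Reasoning

Counts-map : {A B : Set} {_~_ : B → B → Set} {P : A → Set} {Q : B → Set} {N : ℕ} (f : A → B) →
  Counts _≡_ P N → (∀ x → P x → Q (f x)) → (∀ x y → P x → P y → f x ~ f y → x ≡ y) →
  (∀ y → Q y → Σ A (λ x → P x × f x ~ y)) → Counts _~_ Q N
Counts-map {_~_ = _~_} {P} {Q} {N} f c P⇒Q f-injective f-surjective = record
  { elem = f ∘ elem ; valid = λ k → P⇒Q _ (valid k)
  ; distinct = λ k k′ e → distinct k k′ (f-injective _ _ (valid k) (valid k′) e) ; cover = cover′ }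
  where
  open Counts c
  cover′ : ∀ y → Q y → Σ (Fin N) (λ k → f (elem k) ~ y)
  cover′ y q with f-surjective y q
  ... | x , p , fx~y with cover x p
  ... | k , e = k , subst (λ z → f z ~ y) (sym e) fx~y

Counts-transpose : {p q : List ℕ} {N : ℕ} → Counts _≗M_ (RowColSums p q) N → Counts _≗M_ (RowColSums q p) N
Counts-transpose {p} {q} {N} c = record
  { elem = λ k i j → elem k j i ; valid = λ k → proj₂ (valid k) , proj₁ (valid k)
  ; distinct = λ k k′ h → distinct k k′ (λ i j → h j i) ; cover = cover′ }
  where
  open Counts c
  cover′ : ∀ (M : Matrix (length q) (length p)) → RowColSums q p M → Σ (Fin N) (λ k → (λ i j → elem k j i) ≗M M)
  cover′ M (rows , cols) with cover (λ i j → M j i) (cols , rows)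
  ... | k , h = k , λ i j → h j i

DescentsContain? : ∀ m I J (c : Code m) → Dec (DescentsContain m I J c)
DescentsContain? m I J c = map′ to from (allUpTo? left? m ×-dec allUpTo? right? m)
  where
  Left Right : ℕ → Set
  Left i  = I i ≡ true → isLeftDescent m c i ≡ true
  Right j = J j ≡ true → isRightDescent m c j ≡ true
  left? : ∀ i → Dec (Left i)
  left? i = (I i ≟ᵇ true) →-dec (isLeftDescent m c i ≟ᵇ true)
  right? : ∀ j → Dec (Right j)
  right? j = (J j ≟ᵇ true) →-dec (isRightDescent m c j ≟ᵇ true)
  to : (∀ {i} → i < m → Left i) × (∀ {j} → j < m → Right j) → DescentsContain m I J c
  to (l , r) = descents (λ i → l) (λ j → r)
  from : DescentsContain m I J c → (∀ {i} → i < m → Left i) × (∀ {j} → j < m → Right j)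
  from (descents l r) = (λ {i} → l i) , (λ {j} → r j)

codes : ∀ m (I J : Subset m) → Σ ℕ (Counts _≡_ (DescentsContain m (toPred I) (toPred J)))
codes m I J = Code-count m _ (DescentsContain? m (toPred I) (toPred J))

#codes : ∀ m (I J : Subset m) → ℕ
#codes m I J = proj₁ (codes m I J)

codeWord-SimpleIJ : ∀ m (I J : Subset m) c → DescentsContain m (toPred I) (toPred J) c → SimpleIJ m I J (codeWord m c)
codeWord-SimpleIJ m I J c (descents left right) = codeWord-simple m c
  , (λ i i∈I → isLeftDescent⇒InDL m c i (left (toℕ i) (toℕ<n i) (∈⇒toPred I i i∈I)))
  , (λ j j∈J → isRightDescent⇒InDR m c j (right (toℕ j) (toℕ<n j) (∈⇒toPred J j j∈J)))

SimpleIJ-codeWord : ∀ m (I J : Subset m) c → SimpleIJ m I J (codeWord m c) → DescentsContain m (toPred I) (toPred J) c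
SimpleIJ-codeWord m I J c (_ , inDL , inDR) = descents left right
  where
  left : ∀ i → i < m → toPred I i ≡ true → isLeftDescent m c i ≡ true
  left i i<m e = subst (λ z → isLeftDescent m c z ≡ true) (toℕ-fromℕ< i<m) (InDL⇒isLeftDescent m c (fromℕ< i<m)
    (inDL _ (toPred⇒∈ I _ (subst (λ z → toPred I z ≡ true) (sym (toℕ-fromℕ< i<m)) e))))
  right : ∀ j → j < m → toPred J j ≡ true → isRightDescent m c j ≡ true
  right j j<m e = subst (λ z → isRightDescent m c z ≡ true) (toℕ-fromℕ< j<m) (InDR⇒isRightDescent m c (fromℕ< j<m)
    (inDR _ (toPred⇒∈ J _ (subst (λ z → toPred J z ≡ true) (sym (toℕ-fromℕ< j<m)) e))))

SimpleIJ-resp-≈ : ∀ m (I J : Subset m) {x y} → x ≈ y → SimpleIJ m I J x → SimpleIJ m I J y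
SimpleIJ-resp-≈ m I J x≈y ((z , s) , inDL , inDR) = (z , ≈-trans (++-congʳ z (≈-sym x≈y)) s)
  , (λ i i∈I → let (z , h) = inDL i i∈I in z , ≈-trans h x≈y)
  , (λ j j∈J → let (z , h) = inDR j j∈J in z , ≈-trans h x≈y)

simple-count : ∀ m (I J : Subset m) → AHat m I J (#codes m I J)
simple-count m I J = Counts-map (codeWord m) (proj₂ (codes m I J)) (codeWord-SimpleIJ m I J)
  (λ c c′ _ _ → codeWord-injective m c c′) surjective
  where
  surjective : ∀ x → SimpleIJ m I J x →
    Σ (Code m) (λ c → DescentsContain m (toPred I) (toPred J) c × codeWord m c ≈ x)
  surjective x s with simple⇒codeWord m x (proj₁ s)
  ... | c , x≈c = c , SimpleIJ-codeWord m I J c (SimpleIJ-resp-≈ m I J x≈c s) , ≈-sym x≈c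

arrangement-count : ∀ m (I J : Subset m) → Counts _≡_ (Arrangement m (toPred I) (toPred J)) (#codes m I J)
arrangement-count m I J = Counts-map (blockImage m (toPred I)) (proj₂ (codes m I J))
  (blockImage-arrangement m (toPred I) (toPred J)) (blockImage-injective m (toPred I) (toPred J))
  (blockImage-surjective m (toPred I) (toPred J))

matrix-count : ∀ m (I J : Subset m) →
  Counts _≗M_ (RowColSums (compositionOf (toPred I) (suc m)) (compositionOf (toPred J) (suc m))) (#codes m I J)
matrix-count m I J = Counts-map (segmentMatrix (toPred J)) (arrangement-count m I J)
  segmentMatrix-rowColSums
  (λ β β′ v v′ h → trans (sym (matrixWord-segmentMatrix β v))
                          (trans (matrixWord-cong _ _ h) (matrixWord-segmentMatrix β′ v′)))
  (λ M sums → matrixWord M , matrixWord-arrangement M sums , segmentMatrix-matrixWord M sums)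
  where open ArrangementMatrix m (toPred I) (toPred J)

#codes-multinomial : ∀ m (I : Subset m) → #codes m I ⊥ ≡ multinomial (suc m) (compositionOf (toPred I) (suc m))
#codes-multinomial m I = Counts-unique _≡_ sym trans (arrangement-count m I ⊥)
  (content-count (suc m) p (sum-compositionOf (toPred I) m)) arrangement⇒content content⇒arrangement
  where
  p = compositionOf (toPred I) (suc m)
  arrangement⇒content : ∀ β → Arrangement m (toPred I) (toPred (⊥ {m})) β → HasContent p β
  arrangement⇒content β (arrangement len counts _) =
    trans len (sym (sum-compositionOf (toPred I) m)) , (λ a → trans (counts a) (count-blockList (toPred I) m a))
  content⇒arrangement : ∀ β → HasContent p β → Arrangement m (toPred I) (toPred (⊥ {m})) β
  content⇒arrangement β (len , counts) = arrangement (trans len (sum-compositionOf (toPred I) m))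
    (λ a → trans (counts a) (sym (count-blockList (toPred I) m a)))
    (λ j e → ⊥-elim (true≢false (trans (sym e) (toPred-⊥ m j))))

#codes-formula : ∀ m (I : Subset m) → #codes m I ⊥ * product (map _! (composition m I)) ≡ suc m !
#codes-formula m I = begin
  #codes m I ⊥ * product (map _! (composition m I))
    ≡⟨ cong₂ (λ N p → N * product (map _! p)) (#codes-multinomial m I) (composition≡compositionOf m I) ⟩
  multinomial (suc m) p * product (map _! p)
    ≡⟨ multinomial-formula (suc m) p (sum-compositionOf (toPred I) m) ⟩
  suc m ! ∎
  where
  open ≡-Reasoning
  p = compositionOf (toPred I) (suc m)

#codes-swap-⊥ : ∀ m (J : Subset m) → #codes m ⊥ J ≡ #codes m J ⊥
#codes-swap-⊥ m J = Counts-unique _≗M_ (λ h i j → sym (h i j)) (λ h h′ i j → trans (h i j) (h′ i j))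
  (Counts-transpose {compositionOf (toPred (⊥ {m})) (suc m)} {compositionOf (toPred J) (suc m)} (matrix-count m ⊥ J))
  (matrix-count m J ⊥) (λ _ s → s) (λ _ s → s)

proposition3p4 : (m : ℕ) → (I J : Subset m) →
    (Σ ℕ λ N → AHat m I J N ×
      Counts _≗M_ (RowColSums (composition m I) (composition m J)) N)
    × (Σ ℕ λ N → AHat m I ⊥ N × N * product (map _! (composition m I)) ≡ (suc m) !)
    × (Σ ℕ λ N → AHat m ⊥ J N × N * product (map _! (composition m J)) ≡ (suc m) !)
proposition3p4 m I J =
    (#codes m I J , simple-count m I J , matrices)
  , (#codes m I ⊥ , simple-count m I ⊥ , #codes-formula m I)
  , (#codes m ⊥ J , simple-count m ⊥ J ,
     trans (cong (_* product (map _! (composition m J))) (#codes-swap-⊥ m J)) (#codes-formula m J))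
  where
  matrices : Counts _≗M_ (RowColSums (composition m I) (composition m J)) (#codes m I J)
  matrices = subst₂ (λ p q → Counts _≗M_ (RowColSums p q) (#codes m I J))
    (sym (composition≡compositionOf m I)) (sym (composition≡compositionOf m J)) (matrix-count m I J)
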